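{- Let $w=w^{(1)}\oplus w^{(2)}\in S_{n_1+n_2}$ with $w^{(1)}\in S_{n_1}$, $w^{(2)}\in S_{n_2}$, let $C$ be a commutation class of reduced words for $w$, and let $C^{(1)},C^{(2)}$ be the corresponding commutation classes of reduced words for $w^{(1)},w^{(2)}$ (so that $C$ consists of all shuffles of a word in $C^{(1)}$ with a word in $C^{(2)}$ whose entries are shifted by $n_1$). Let $\rho,\rho^{(1)},\rho^{(2)}$ be the uniform vote tallies on $\operatorname{Pre}(C),\operatorname{Pre}(C^{(1)}),\operatorname{Pre}(C^{(2)})$ respectively. For $i=1,2$ let $u^{(i)},v^{(i)}\in\operatorname{Pre}(C^{(i)})$ be the permutations with $\operatorname{Inv}(u^{(i)})=\{ab\in\operatorname{Inv}(w^{(i)}):\Sigma_{\rho^{(i)}}(ab)>\frac12|\rho^{(i)}|\}$ and $\operatorname{Inv}(v^{(i)})=\{ab\in\operatorname{Inv}(w^{(i)}):\Sigma_{\rho^{(i)}}(ab)\ge\frac12|\rho^{(i)}|\}$ (so that $\triangleleft_{\rho^{(i)}}$ equals $<_{u^{(i)}}\cap<_{v^{(i)}}$). Then $\triangleleft_\rho$ equals $<_u\cap<_v$, where $u=u^{(1)}\oplus u^{(2)}$ and $v=v^{(1)}\oplus v^{(2)}$.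
   Context: For $w=(w_1,\dots,w_n)\in S_n$, $<_w$ denotes the linear order $w_1<_w\cdots<_w w_n$ on $[n]$, and $\operatorname{Inv}(w)=\{(a,b):1\le a<b\le n,\ b<_w a\}$, pairs written $ab$. Let $s_i$ be the adjacent transposition of $i,i+1$; $ws_i$ is obtained from $w$ by swapping the entries in positions $i,i+1$. A reduced word for $w$ is $(i_1,\dots,i_\ell)$ with $w=s_{i_1}\cdots s_{i_\ell}$, $\ell=|\operatorname{Inv}(w)|$. The commutation class $C(\mathbf i)$ is the set of words obtained from $\mathbf i$ by repeatedly swapping adjacent entries differing by at least $2$. $\operatorname{Pre}(C)$ is the set of all $s_{i'_1}\cdots s_{i'_m}$ with $(i'_1,\dots,i'_m)$ a prefix of a word in $C$. The direct sum of $w^{(1)}\in S_{n_1}$ and $w^{(2)}\in S_{n_2}$ is $w^{(1)}\oplus w^{(2)}=(w^{(1)}_1,\dots,w^{(1)}_{n_1},n_1+w^{(2)}_1,\dots,n_1+w^{(2)}_{n_2})\in S_{n_1+n_2}$. The uniform vote tally on $\operatorname{Pre}(C)$ is $\mathbb 1_{\operatorname{Pre}(C)}$ (value $1$ on $\operatorname{Pre}(C)$, $0$ elsewhere); for a vote tally $\rho$, $|\rho|=\sum_w\rho(w)$, the $\rho$-tally function is $\Sigma_\rho(ab)=\sum_{w'\in\operatorname{Pre}(C):\,ab\in\operatorname{Inv}(w')}\rho(w')$, and the majority relation is $a\triangleleft_\rho b$ iff $\sum_{w':\,a<_{w'}b}\rho(w')>\sum_{w':\,b<_{w'}a}\rho(w')$.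 -}

module Defs where

open import Data.Nat using (ℕ; zero; suc; _+_; _*_; _∸_; _≤_; _<_; _<?_)
open import Data.List using (List; []; _∷_; _++_; [_]; map; foldl; upTo; length; filter)
open import Data.List.Relation.Unary.All using (All)
open import Data.List.Relation.Unary.Unique.Propositional using (Unique)
open import Data.List.Membership.Propositional using (_∈_)
open import Data.List.Relation.Binary.Permutation.Propositional using (_↭_)
open import Data.Product using (Σ; ∃; ∃₂; _×_; _,_)
open import Data.Sum using (_⊎_)
open import Function.Bundles using (_⇔_)
open import Relation.Binary.PropositionalEquality using (_≡_)
open import Relation.Binary.Construct.Closure.ReflexiveTransitive using (Star)

-- Permutations in one-line notation: a list w = (w₁,…,wₙ) of the values 1..n.
idPerm : ℕ → List ℕ
idPerm n = map suc (upTo n)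

IsPerm : ℕ → List ℕ → Set
IsPerm n w = w ↭ idPerm n

Before : List ℕ → ℕ → ℕ → Set
Before w x y = Σ (List ℕ) λ l₁ → Σ (List ℕ) λ l₂ → Σ (List ℕ) λ l₃ →
  w ≡ l₁ ++ [ x ] ++ l₂ ++ [ y ] ++ l₃

InInv : List ℕ → ℕ → ℕ → Set
InInv w a b = (a < b) × Before w b a

HasCard : {A : Set} → (A → Set) → ℕ → Set
HasCard {A} P k = Σ (List A) λ L → Unique L × (∀ x → (x ∈ L) ⇔ P x) × (length L ≡ k)

-- w s_i : swap the entries in positions i, i+1 (positions are 1-indexed).
swapAt : ℕ → List ℕ → List ℕ
swapAt (suc zero) (x ∷ y ∷ r) = y ∷ x ∷ r
swapAt (suc (suc k)) (x ∷ r) = x ∷ swapAt (suc k) r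
swapAt _ l = l

prod : ℕ → List ℕ → List ℕ
prod n word = foldl (λ w i → swapAt i w) (idPerm n) word

Letters : ℕ → List ℕ → Set
Letters n word = All (λ i → (1 ≤ i) × (i < n)) word

IsReducedWord : ℕ → List ℕ → List ℕ → Set
IsReducedWord n w word =
  Letters n word × (prod n word ≡ w) × HasCard (λ (p : ℕ × ℕ) → let (a , b) = p in InInv w a b) (length word)

data CommStep : List ℕ → List ℕ → Set where
  comm : ∀ (l₁ l₂ : List ℕ) (i j : ℕ) → (i + 2 ≤ j) ⊎ (j + 2 ≤ i) →
         CommStep (l₁ ++ i ∷ j ∷ l₂) (l₁ ++ j ∷ i ∷ l₂)

InCommClass : List ℕ → List ℕ → Set
InCommClass i j = Star CommStep i j

InPre : ℕ → List ℕ → List ℕ → Set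
InPre n i w' = Σ (List ℕ) λ j → InCommClass i j × Σ (List ℕ) λ p → Σ (List ℕ) λ q →
  (j ≡ p ++ q) × (w' ≡ prod n p)

-- Uniform tally ρ = 𝟙_{Pre(C(i))}: |ρ| = #Pre(C), Σ_ρ(ab) = #{w' ∈ Pre(C) : ab ∈ Inv(w')}.
-- Σ_ρ(ab) > ½|ρ|
TallyGt : ℕ → List ℕ → ℕ → ℕ → Set
TallyGt n i a b = ∃₂ λ s t → HasCard (InPre n i) s ×
  HasCard (λ w' → InPre n i w' × InInv w' a b) t × (s < 2 * t)

TallyGe : ℕ → List ℕ → ℕ → ℕ → Set
TallyGe n i a b = ∃₂ λ s t → HasCard (InPre n i) s ×
  HasCard (λ w' → InPre n i w' × InInv w' a b) t × (s ≤ 2 * t)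

Majority : ℕ → List ℕ → ℕ → ℕ → Set
Majority n i a b = ∃₂ λ k₁ k₂ →
  HasCard (λ w' → InPre n i w' × Before w' a b) k₁ ×
  HasCard (λ w' → InPre n i w' × Before w' b a) k₂ × (k₂ < k₁)

_⊕_ : ℕ → List ℕ → List ℕ → List ℕ
_⊕_ n₁ w₁ w₂ = w₁ ++ map (n₁ +_) w₂

-- the words of C⁽¹⁾, C⁽²⁾ corresponding to a word i for w¹ ⊕ w²
lowPart : ℕ → List ℕ → List ℕ
lowPart n₁ i = filter (_<? n₁) i

highPart : ℕ → List ℕ → List ℕ
highPart n₁ i = map (_∸ n₁) (filter (n₁ <?_) i)

-- Prefixes of a reduced word are reduced, so every element of Pre(C) lies below w = w₁ ⊕ w₂ in
-- the weak order. As w has no inversion across its two blocks, no word of C contains the letter n₁,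
-- and Pre(C) is exactly {x ⊕ y : x ∈ Pre(C⁽¹⁾), y ∈ Pre(C⁽²⁾)}. Counting over this product, for a, b
-- in the same block the number of prefixes with a before b is the corresponding count for that block
-- times |Pre| of the other block, so the majority relations agree; values in different blocks are
-- ordered by every prefix, and by u and v, as in w.
-- Within a single class of reduced words for some w and for a < b, the hypotheses on u and v say that
-- ab ∈ Inv(u) iff ab ∈ Inv(w) and b ◁ a, and ab ∈ Inv(v) iff ab ∈ Inv(w) and not a ◁ b; a pair that is
-- not an inversion of w is ordered alike by every prefix. With the asymmetry of ◁ this gives
-- ◁ = <_u ∩ <_v.

module Submission where

open import Data.Empty using (⊥; ⊥-elim)
open import Data.List
  using (List; []; _∷_; _++_; [_]; _∷ʳ_; map; concatMap; cartesianProductWith; initLast; _∷ʳ′_; inits;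
         deduplicate; foldl; length; filter; upTo; applyUpTo)
open import Data.List.Properties
  using (≡-dec; map-injective; ++-cancelˡ; ∷-injectiveˡ; ∷-injectiveʳ; ++-identityʳ; ++-assoc; foldl-++;
         length-map; length-upTo; length-++; map-upTo; map-∘; map-cong; map-++; map-id-local;
         filter-accept; filter-reject; filter-++; filter-none; filter-all)
open import Data.List.Membership.Propositional using (_∈_; find; lose)
open import Data.List.Membership.Propositional.Properties
  using (∈-∃++; ∈-++⁺ˡ; ∈-++⁺ʳ; ∈-++⁻; ∈-map⁺; ∈-map⁻; ∈-filter⁺; ∈-filter⁻; ∈-upTo⁺; ∈-upTo⁻;
         ∈-concatMap⁺; ∈-concatMap⁻; ∈-deduplicate⁺; ∈-deduplicate⁻;
         ∈-cartesianProductWith⁺; ∈-cartesianProductWith⁻)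
import Data.List.Membership.DecPropositional as DecMembership
open import Data.List.Relation.Binary.Permutation.Propositional
  using (_↭_; ↭-refl; ↭-sym; ↭-trans; ↭-prep; ↭-swap; ↭⇒↭ₛ)
open import Data.List.Relation.Binary.Permutation.Propositional.Properties
  using (∈-resp-↭; shift; ↭-length; ++⁺ˡ; All-resp-↭; filter-↭)
import Data.List.Relation.Binary.Permutation.Setoid.Properties as Permutationₛ
open import Data.List.Relation.Unary.All as All using (All; []; _∷_)
open import Data.List.Relation.Unary.All.Properties as Allₚ using (all-filter)
open import Data.List.Relation.Unary.AllPairs using ([]; _∷_)
open import Data.List.Relation.Unary.Any using (here; there; any?)
import Data.List.Relation.Unary.First as First
open import Data.List.Relation.Unary.First.Properties using (toView)
open import Data.List.Relation.Unary.Unique.Propositional using (Unique)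
import Data.List.Relation.Unary.Unique.Propositional.Properties as Unique
open import Data.List.Relation.Unary.Unique.DecPropositional.Properties using (deduplicate-!)
open import Data.Nat using (ℕ; zero; suc; _+_; _*_; _∸_; _≤_; _<_; _<?_; _≤?_; z≤n; s≤s; z<s; s<s)
open import Data.Nat.Properties
open import Algebra.Properties.CommutativeSemigroup +-commutativeSemigroup using (x∙yz≈y∙xz)
open import Data.Product using (∃; ∃₂; _×_; _,_; proj₁; proj₂)
open import Data.Product.Function.NonDependent.Propositional using (_×-⇔_)
open import Data.Sum as Sum using (_⊎_; inj₁; inj₂; [_,_]′)
open import Data.Unit using (⊤)
open import Defs
open import Function using (_∘_; id)
open import Function.Bundles using (_⇔_; mk⇔; Equivalence)
open Equivalence using (to; from)
open import Function.Properties.Equivalence using (⇔-setoid)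
  renaming (refl to ⇔-refl; sym to ⇔-sym; trans to ⇔-trans)
open import Function.Related.TypeIsomorphisms using (¬-cong-⇔)
open import Level using (0ℓ)
open import Relation.Binary.Construct.Closure.ReflexiveTransitive as Star using (Star; ε; _◅_; _◅◅_)
open import Relation.Binary.Construct.Closure.ReflexiveTransitive.Properties using (module StarReasoning)
open import Relation.Binary.Definitions using (DecidableEquality; tri<; tri≈; tri>)
open import Relation.Binary.PropositionalEquality
  using (_≡_; _≢_; refl; sym; trans; cong; cong₂; subst; subst₂; setoid; module ≡-Reasoning)
import Relation.Binary.Reasoning.Setoid as SetoidReasoning
open import Relation.Nullary using (¬_; Dec; yes; no; ¬?)
open import Relation.Nullary.Decidable as Dec using (map′; _×-dec_; _⊎-dec_; decidable-stable)

module ⇔-Reasoning = SetoidReasoning (⇔-setoid 0ℓ)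

open DecMembership _≟_ using (_∈?_)

-- Relative order of entries in a list

Before-head : ∀ {x y r} → y ∈ r → Before (x ∷ r) x y
Before-head y∈r with l₂ , l₃ , refl ← ∈-∃++ y∈r = [] , l₂ , l₃ , refl

Before-tail : ∀ {x y z r} → Before r x y → Before (z ∷ r) x y
Before-tail {z = z} (l₁ , l₂ , l₃ , refl) = z ∷ l₁ , l₂ , l₃ , refl

¬Before-[] : ∀ {x y} → ¬ Before [] x y
¬Before-[] ([] , _ , _ , ())
¬Before-[] (_ ∷ _ , _ , _ , ())

Before-∷⁻ : ∀ {x y z r} → Before (z ∷ r) x y → (z ≡ x × y ∈ r) ⊎ Before r x y
Before-∷⁻ ([] , l₂ , l₃ , refl) = inj₁ (refl , ∈-++⁺ʳ l₂ (here refl))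
Before-∷⁻ (_ ∷ l₁ , l₂ , l₃ , refl) = inj₂ (l₁ , l₂ , l₃ , refl)

Before? : ∀ w x y → Dec (Before w x y)
Before? [] x y = no ¬Before-[]
Before? (z ∷ r) x y =
  map′ [ (λ { (refl , y∈r) → Before-head y∈r }) , Before-tail ]′ Before-∷⁻
       (((z ≟ x) ×-dec (y ∈? r)) ⊎-dec Before? r x y)

Before⇒∈ : ∀ {w x y} → Before w x y → x ∈ w × y ∈ w
Before⇒∈ {w = _ ∷ r} b with Before-∷⁻ b
... | inj₁ (refl , y∈r) = here refl , there y∈r
... | inj₂ b′ = let x∈r , y∈r = Before⇒∈ b′ in there x∈r , there y∈r
Before⇒∈ {w = []} b = ⊥-elim (¬Before-[] b)

Before-asym : ∀ {w x y} → Unique w → Before w x y → ¬ Before w y x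
Before-asym {w = []} _ b = ⊥-elim (¬Before-[] b)
Before-asym {w = _ ∷ r} (z≢r ∷ r!) b b′ with Before-∷⁻ b | Before-∷⁻ b′
... | inj₁ (refl , y∈r) | inj₁ (refl , _) = All.lookup z≢r y∈r refl
... | inj₁ (refl , _) | inj₂ b″ = All.lookup z≢r (proj₂ (Before⇒∈ b″)) refl
... | inj₂ b″ | inj₁ (refl , _) = All.lookup z≢r (proj₂ (Before⇒∈ b″)) refl
... | inj₂ b″ | inj₂ b‴ = Before-asym r! b″ b‴

Before-total : ∀ {w x y} → x ∈ w → y ∈ w → x ≢ y → Before w x y ⊎ Before w y x
Before-total (here refl) (here refl) x≢y = ⊥-elim (x≢y refl)
Before-total (here refl) (there y∈r) _ = inj₁ (Before-head y∈r)
Before-total (there x∈r) (here refl) _ = inj₂ (Before-head x∈r)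
Before-total (there x∈r) (there y∈r) x≢y with Before-total x∈r y∈r x≢y
... | inj₁ b = inj₁ (Before-tail b)
... | inj₂ b = inj₂ (Before-tail b)

Before-++⁺ˡ : ∀ {u} v {x y} → Before u x y → Before (u ++ v) x y
Before-++⁺ˡ v (l₁ , l₂ , l₃ , refl) = l₁ , l₂ , l₃ ++ v ,
  trans (++-assoc l₁ _ v) (cong (λ t → l₁ ++ _ ∷ t) (++-assoc l₂ _ v))

Before-++⁺ʳ : ∀ u {v x y} → Before v x y → Before (u ++ v) x y
Before-++⁺ʳ [] b = b
Before-++⁺ʳ (_ ∷ u) b = Before-tail (Before-++⁺ʳ u b)

Before-++-across : ∀ {u v x y} → x ∈ u → y ∈ v → Before (u ++ v) x y
Before-++-across {_ ∷ u} (here refl) y∈v = Before-head (∈-++⁺ʳ u y∈v)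
Before-++-across (there x∈u) y∈v = Before-tail (Before-++-across x∈u y∈v)

Before-++⁻ : ∀ u {v x y} → Before (u ++ v) x y → Before u x y ⊎ (x ∈ u × y ∈ v) ⊎ Before v x y
Before-++⁻ [] b = inj₂ (inj₂ b)
Before-++⁻ (z ∷ u) b with Before-∷⁻ b
... | inj₁ (refl , y∈u++v) with ∈-++⁻ u y∈u++v
...   | inj₁ y∈u = inj₁ (Before-head y∈u)
...   | inj₂ y∈v = inj₂ (inj₁ (here refl , y∈v))
Before-++⁻ (z ∷ u) b | inj₂ b′ with Before-++⁻ u b′
...   | inj₁ b″ = inj₁ (Before-tail b″)
...   | inj₂ (inj₁ (x∈u , y∈v)) = inj₂ (inj₁ (there x∈u , y∈v))
...   | inj₂ (inj₂ b″) = inj₂ (inj₂ b″)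

Before-map⁺ : ∀ (f : ℕ → ℕ) {w x y} → Before w x y → Before (map f w) (f x) (f y)
Before-map⁺ f {w = _ ∷ r} b with Before-∷⁻ b
... | inj₁ (refl , y∈r) = Before-head (∈-map⁺ f y∈r)
... | inj₂ b′ = Before-tail (Before-map⁺ f b′)
Before-map⁺ f {w = []} b = ⊥-elim (¬Before-[] b)

Before-map⁻ : ∀ {f : ℕ → ℕ} → (∀ {x y} → f x ≡ f y → x ≡ y) →
              ∀ {w x y} → Before (map f w) (f x) (f y) → Before w x y
Before-map⁻ f-inj {w = _ ∷ r} b with Before-∷⁻ b
... | inj₂ b′ = Before-tail (Before-map⁻ f-inj b′)
... | inj₁ (fz≡fx , fy∈fr) with ∈-map⁻ _ fy∈fr
...   | _ , y′∈r , fy≡fy′ rewrite f-inj fz≡fx | f-inj fy≡fy′ = Before-head y′∈r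
Before-map⁻ f-inj {w = []} b = ⊥-elim (¬Before-[] b)

-- Duplicate-free enumerations

record Enumeration {A : Set} (P : A → Set) : Set where
  constructor enumeration
  field
    list   : List A
    unique : Unique list
    ∈⇔     : ∀ x → x ∈ list ⇔ P x

  size : ℕ
  size = length list

  ∈⁻ : ∀ {x} → x ∈ list → P x
  ∈⁻ = to (∈⇔ _)

  ∈⁺ : ∀ {x} → P x → x ∈ list
  ∈⁺ = from (∈⇔ _)

open Enumeration

unique-⊆⇒length≤ : ∀ {A : Set} {L U : List A} → Unique L → (∀ {x} → x ∈ L → x ∈ U) → length L ≤ length U
unique-⊆⇒length≤ {L = []} _ _ = z≤n
unique-⊆⇒length≤ {L = x ∷ L} {U} (x≢L ∷ L!) L⊆U with U₁ , U₂ , refl ← ∈-∃++ (L⊆U (here refl)) =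
  ≤-trans (s≤s (unique-⊆⇒length≤ L! L⊆U₁U₂)) (≤-reflexive (sym (↭-length (shift x U₁ U₂))))
  where
  L⊆U₁U₂ : ∀ {y} → y ∈ L → y ∈ U₁ ++ U₂
  L⊆U₁U₂ {y} y∈L with ∈-resp-↭ (shift x U₁ U₂) (L⊆U (there y∈L))
  ... | here refl = ⊥-elim (All.lookup x≢L y∈L refl)
  ... | there y∈U₁U₂ = y∈U₁U₂

size-unique : ∀ {A : Set} {P : A → Set} (e e′ : Enumeration P) → size e ≡ size e′
size-unique e e′ =
  ≤-antisym (unique-⊆⇒length≤ (unique e) (∈⁺ e′ ∘ ∈⁻ e)) (unique-⊆⇒length≤ (unique e′) (∈⁺ e ∘ ∈⁻ e′))

HasCard⇔≡size : ∀ {A : Set} {P : A → Set} (e : Enumeration P) {k} → HasCard P k ⇔ (k ≡ size e)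
HasCard⇔≡size e = mk⇔
  (λ { (L , L! , ∈L , refl) → size-unique (enumeration L L! ∈L) e })
  (λ { refl → list e , unique e , ∈⇔ e , refl })

-- Majority, TallyGt and TallyGe all have this shape.
HasCard₂⇔ : ∀ {A : Set} {P Q : A → Set} (e : Enumeration P) (e′ : Enumeration Q) (R : ℕ → ℕ → Set) →
            (∃₂ λ k k′ → HasCard P k × HasCard Q k′ × R k k′) ⇔ R (size e) (size e′)
HasCard₂⇔ e e′ R = mk⇔
  (λ { (k , k′ , c , c′ , r) → subst₂ R (to (HasCard⇔≡size e) c) (to (HasCard⇔≡size e′) c′) r })
  (λ r → size e , size e′ , from (HasCard⇔≡size e) refl , from (HasCard⇔≡size e′) refl , r)

filterᴱ : ∀ {A : Set} {P Q : A → Set} → Enumeration P → (Q? : ∀ x → Dec (Q x)) → Enumeration (λ x → P x × Q x)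
filterᴱ e Q? = enumeration (filter Q? (list e)) (Unique.filter⁺ Q? (unique e)) λ x → mk⇔
  (λ x∈ → let x∈L , q = ∈-filter⁻ Q? x∈ in ∈⁻ e x∈L , q)
  (λ (p , q) → ∈-filter⁺ Q? (∈⁺ e p) q)

respᴱ : ∀ {A : Set} {P Q : A → Set} → Enumeration P → (∀ x → P x ⇔ Q x) → Enumeration Q
respᴱ e P⇔Q = enumeration (list e) (unique e) λ x → ⇔-trans (∈⇔ e x) (P⇔Q x)

∈⇒1≤length : ∀ {A : Set} {x : A} {L} → x ∈ L → 1 ≤ length L
∈⇒1≤length (here _) = s≤s z≤n
∈⇒1≤length (there _) = s≤s z≤n

length-filter-partition : ∀ {A : Set} {P Q : A → Set} (P? : ∀ x → Dec (P x)) (Q? : ∀ x → Dec (Q x)) L →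
  (∀ {x} → x ∈ L → (P x ⊎ Q x) × ¬ (P x × Q x)) → length (filter P? L) + length (filter Q? L) ≡ length L
length-filter-partition P? Q? [] _ = refl
length-filter-partition P? Q? (x ∷ L) PQ with P? x | Q? x | length-filter-partition P? Q? L (PQ ∘ there)
... | yes p | yes q | _ = ⊥-elim (proj₂ (PQ (here refl)) (p , q))
... | yes _ | no _ | ih = cong suc ih
... | no _ | yes _ | ih = trans (+-suc _ _) (cong suc ih)
... | no ¬p | no ¬q | _ = ⊥-elim ([ ¬p , ¬q ]′ (proj₁ (PQ (here refl))))

length-filter-++ : ∀ {A : Set} {P : A → Set} (P? : ∀ x → Dec (P x)) u v →
                   length (filter P? (u ++ v)) ≡ length (filter P? u) + length (filter P? v)
length-filter-++ P? u v = trans (cong length (filter-++ P? u v)) (length-++ (filter P? u))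

length-filter-map : ∀ {A B : Set} {P : A → Set} {Q : B → Set} (P? : ∀ x → Dec (P x)) (Q? : ∀ y → Dec (Q y))
                    (g : B → A) ys → (∀ {y} → y ∈ ys → P (g y) ⇔ Q y) →
                    length (filter P? (map g ys)) ≡ length (filter Q? ys)
length-filter-map P? Q? g [] _ = refl
length-filter-map P? Q? g (y ∷ ys) P⇔Q with P? (g y) | Q? y | length-filter-map P? Q? g ys (P⇔Q ∘ there)
... | yes _ | yes _ | ih = cong suc ih
... | no _ | no _ | ih = ih
... | yes Pgy | no ¬Qy | _ = ⊥-elim (¬Qy (to (P⇔Q (here refl)) Pgy))
... | no ¬Pgy | yes Qy | _ = ⊥-elim (¬Pgy (from (P⇔Q (here refl)) Qy))

++-cancel-sameLength : ∀ {A : Set} (u u′ : List A) {v v′} → length u ≡ length u′ → u ++ v ≡ u′ ++ v′ → u ≡ u′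
++-cancel-sameLength [] [] _ _ = refl
++-cancel-sameLength (x ∷ u) (x′ ∷ u′) |u|≡ eq =
  cong₂ _∷_ (∷-injectiveˡ eq) (++-cancel-sameLength u u′ (suc-injective |u|≡) (∷-injectiveʳ eq))

module _ {A B C : Set} (f : A → B → C) where

  Unique-cartesianProductWith : ∀ {xs ys} →
    (∀ {x x′ y y′} → x ∈ xs → x′ ∈ xs → f x y ≡ f x′ y′ → x ≡ x′) → (∀ {x y y′} → f x y ≡ f x y′ → y ≡ y′) →
    Unique xs → Unique ys → Unique (cartesianProductWith f xs ys)
  Unique-cartesianProductWith {[]} _ _ _ _ = []
  Unique-cartesianProductWith {x ∷ xs} {ys} f-injˡ f-injʳ (x≢xs ∷ xs!) ys! =
    Unique.++⁺ (Unique.map⁺ f-injʳ ys!)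
      (Unique-cartesianProductWith (λ x∈ x′∈ → f-injˡ (there x∈) (there x′∈)) f-injʳ xs! ys!) disjoint
    where
    disjoint : ∀ {z} → ¬ (z ∈ map (f x) ys × z ∈ cartesianProductWith f xs ys)
    disjoint (z∈ , z∈′)
      with _ , _ , refl ← ∈-map⁻ (f x) z∈
      with x′ , _ , x′∈ , _ , z≡ ← ∈-cartesianProductWith⁻ f xs ys z∈′ =
      All.lookup x≢xs x′∈ (f-injˡ (here refl) (there x′∈) z≡)

module _ {A B C : Set} (f : A → B → C) {R : C → Set} (R? : ∀ z → Dec (R z)) where

  length-filter-cartesianProductWithˡ : ∀ {P : A → Set} (P? : ∀ x → Dec (P x)) xs ys →
    (∀ {x y} → x ∈ xs → y ∈ ys → R (f x y) ⇔ P x) →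
    length (filter R? (cartesianProductWith f xs ys)) ≡ length (filter P? xs) * length ys
  length-filter-cartesianProductWithˡ P? [] ys _ = refl
  length-filter-cartesianProductWithˡ P? (x ∷ xs) ys R⇔P
    rewrite length-filter-++ R? (map (f x) ys) (cartesianProductWith f xs ys)
          | length-filter-cartesianProductWithˡ P? xs ys (R⇔P ∘ there)
    with P? x
  ... | yes Px = cong (_+ _) (trans (cong length (filter-all R? (Allₚ.map⁺ (All.tabulate all-R))))
                                    (length-map (f x) ys))
    where
    all-R : ∀ {y} → y ∈ ys → R (f x y)
    all-R y∈ = from (R⇔P (here refl) y∈) Px
  ... | no ¬Px = cong (_+ _) (cong length (filter-none R? (Allₚ.map⁺ (All.tabulate none-R))))
    where
    none-R : ∀ {y} → y ∈ ys → ¬ R (f x y)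
    none-R y∈ = ¬Px ∘ to (R⇔P (here refl) y∈)

  length-filter-cartesianProductWithʳ : ∀ {Q : B → Set} (Q? : ∀ y → Dec (Q y)) xs ys →
    (∀ {x y} → x ∈ xs → y ∈ ys → R (f x y) ⇔ Q y) →
    length (filter R? (cartesianProductWith f xs ys)) ≡ length xs * length (filter Q? ys)
  length-filter-cartesianProductWithʳ Q? [] ys _ = refl
  length-filter-cartesianProductWithʳ Q? (x ∷ xs) ys R⇔Q =
    trans (length-filter-++ R? (map (f x) ys) (cartesianProductWith f xs ys))
      (cong₂ _+_ (length-filter-map R? Q? (f x) ys (R⇔Q (here refl)))
                 (length-filter-cartesianProductWithʳ Q? xs ys (R⇔Q ∘ there)))

module _ {A : Set} (_≟ᴬ_ : DecidableEquality A) {R : A → A → Set} (next : A → List A)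
         (next-sound : ∀ {x y} → y ∈ next x → R x y) (next-complete : ∀ {x y} → R x y → y ∈ next x) where

  private
    open DecMembership _≟ᴬ_ using () renaming (_∈?_ to _∈ᴬ?_)

    -- S is a duplicate-free subset of U, so the bound makes fuel = 0 impossible.
    grow : ∀ k U → (∀ {x} → Star R k x → x ∈ U) → ∀ fuel S → Unique S → (∀ {x} → x ∈ S → Star R k x) → k ∈ S →
           length U < length S + fuel → Enumeration (Star R k)
    grow k U ⊆U zero S S! ⊆reach _ bound =
      ⊥-elim (<⇒≱ (subst (length U <_) (+-identityʳ _) bound) (unique-⊆⇒length≤ S! (⊆U ∘ ⊆reach)))
    grow k U ⊆U (suc fuel) S S! ⊆reach k∈S bound with any? (λ y → ¬? (y ∈ᴬ? S)) (concatMap next S)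
    ... | no closed = enumeration S S! λ x → mk⇔ ⊆reach (reach⇒∈ k∈S)
      where
      reach⇒∈ : ∀ {s x} → s ∈ S → Star R s x → x ∈ S
      reach⇒∈ s∈S ε = s∈S
      reach⇒∈ {s} s∈S (_◅_ {j = z} sRz steps) with z ∈ᴬ? S
      ... | yes z∈S = reach⇒∈ z∈S steps
      ... | no z∉S = ⊥-elim (closed (lose (∈-concatMap⁺ next (lose s∈S (next-complete sRz))) z∉S))
    ... | yes new
      with y , y∈next , y∉S ← find new
      with s , s∈S , y∈next-s ← find (∈-concatMap⁻ next {xs = S} y∈next) =
      grow k U ⊆U fuel (y ∷ S) (Allₚ.¬Any⇒All¬ S y∉S ∷ S!) ⊆reach′ (there k∈S)
        (subst (length U <_) (+-suc _ fuel) bound)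
      where
      ⊆reach′ : ∀ {x} → x ∈ y ∷ S → Star R k x
      ⊆reach′ (here refl) = ⊆reach s∈S ◅◅ (next-sound y∈next-s ◅ ε)
      ⊆reach′ (there x∈S) = ⊆reach x∈S

  enumerateReachable : ∀ k U → (∀ {x} → Star R k x → x ∈ U) → Enumeration (Star R k)
  enumerateReachable k U ⊆U =
    grow k U ⊆U (length U) [ k ] ([] ∷ []) (λ { (here refl) → ε }) (here refl) ≤-refl

-- Products of adjacent transpositions

Far : ℕ → ℕ → Set
Far i j = (i + 2 ≤ j) ⊎ (j + 2 ≤ i)

-- prod n word is definitionally idPerm n · word.
infixl 5 _·_
_·_ : List ℕ → List ℕ → List ℕ
w · word = foldl (λ v i → swapAt i v) w word

swapAt-↭ : ∀ k w → swapAt k w ↭ w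
swapAt-↭ (suc zero) (x ∷ y ∷ r) = ↭-swap y x ↭-refl
swapAt-↭ (suc (suc k)) (x ∷ r) = ↭-prep x (swapAt-↭ (suc k) r)
swapAt-↭ zero _ = ↭-refl
swapAt-↭ (suc zero) [] = ↭-refl
swapAt-↭ (suc zero) (_ ∷ []) = ↭-refl
swapAt-↭ (suc (suc k)) [] = ↭-refl

swapAt-map : ∀ (f : ℕ → ℕ) k w → swapAt k (map f w) ≡ map f (swapAt k w)
swapAt-map f (suc zero) (x ∷ y ∷ r) = refl
swapAt-map f (suc (suc k)) (x ∷ r) = cong (f x ∷_) (swapAt-map f (suc k) r)
swapAt-map f zero _ = refl
swapAt-map f (suc zero) [] = refl
swapAt-map f (suc zero) (_ ∷ []) = refl
swapAt-map f (suc (suc k)) [] = refl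

swapAt-++ˡ : ∀ k u v → k < length u → swapAt k (u ++ v) ≡ swapAt k u ++ v
swapAt-++ˡ zero u v _ = refl
swapAt-++ˡ (suc zero) (x ∷ y ∷ u) v _ = refl
swapAt-++ˡ (suc (suc k)) (x ∷ u) v (s≤s k<|u|) = cong (x ∷_) (swapAt-++ˡ (suc k) u v k<|u|)
swapAt-++ˡ (suc zero) (x ∷ []) v (s≤s ())

swapAt-++ʳ : ∀ u v k → swapAt (suc (length u + k)) (u ++ v) ≡ u ++ swapAt (suc k) v
swapAt-++ʳ [] v k = refl
swapAt-++ʳ (x ∷ u) v k = cong (x ∷_) (swapAt-++ʳ u v k)

swapAt-middle : ∀ u (x y : ℕ) v → swapAt (suc (length u)) (u ++ x ∷ y ∷ v) ≡ u ++ y ∷ x ∷ v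
swapAt-middle [] x y v = refl
swapAt-middle (z ∷ u) x y v = cong (z ∷_) (swapAt-middle u x y v)

swapAt-comm : ∀ {i j} → i + 2 ≤ j → ∀ w → swapAt i (swapAt j w) ≡ swapAt j (swapAt i w)
swapAt-comm {zero} _ w = refl
swapAt-comm {suc zero} {suc (suc (suc j))} _ (x ∷ y ∷ w) = refl
swapAt-comm {suc zero} {suc (suc (suc j))} _ [] = refl
swapAt-comm {suc zero} {suc (suc (suc j))} _ (_ ∷ []) = refl
swapAt-comm {suc (suc i)} {suc (suc j)} (s≤s (s≤s i+2≤j)) (x ∷ w) = cong (x ∷_) (swapAt-comm (s≤s i+2≤j) w)
swapAt-comm {suc (suc i)} {suc (suc j)} _ [] = refl
swapAt-comm {suc zero} {suc zero} (s≤s ())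
swapAt-comm {suc zero} {suc (suc zero)} (s≤s (s≤s ()))

swapAt-comm-Far : ∀ {i j} → Far i j → ∀ w → swapAt j (swapAt i w) ≡ swapAt i (swapAt j w)
swapAt-comm-Far (inj₁ i+2≤j) w = sym (swapAt-comm i+2≤j w)
swapAt-comm-Far (inj₂ j+2≤i) w = swapAt-comm j+2≤i w

·-↭ : ∀ w word → w · word ↭ w
·-↭ w [] = ↭-refl
·-↭ w (k ∷ word) = ↭-trans (·-↭ (swapAt k w) word) (swapAt-↭ k w)

·-++ : ∀ w p q → w · (p ++ q) ≡ w · p · q
·-++ w p q = foldl-++ (λ v i → swapAt i v) w p q

·-CommStep : ∀ w {p q} → CommStep p q → w · p ≡ w · q
·-CommStep w (comm l₁ l₂ i j far) = begin
  w · (l₁ ++ i ∷ j ∷ l₂)                    ≡⟨ ·-++ w l₁ _ ⟩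
  swapAt j (swapAt i (w · l₁)) · l₂          ≡⟨ cong (_· l₂) (swapAt-comm-Far far (w · l₁)) ⟩
  swapAt i (swapAt j (w · l₁)) · l₂          ≡⟨ ·-++ w l₁ _ ⟨
  w · (l₁ ++ j ∷ i ∷ l₂)                    ∎
  where open ≡-Reasoning

length-idPerm : ∀ n → length (idPerm n) ≡ n
length-idPerm n = trans (length-map suc (upTo n)) (length-upTo n)

length-prod : ∀ n p → length (prod n p) ≡ n
length-prod n p = trans (↭-length (·-↭ (idPerm n) p)) (length-idPerm n)

Unique-idPerm : ∀ n → Unique (idPerm n)
Unique-idPerm n = Unique.map⁺ suc-injective (Unique.upTo⁺ n)

Unique-resp-↭ : ∀ {u v : List ℕ} → u ↭ v → Unique u → Unique v
Unique-resp-↭ u↭v = Permutationₛ.Unique-resp-↭ (setoid ℕ) (↭⇒↭ₛ u↭v)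

IsPerm⇒Unique : ∀ {n w} → IsPerm n w → Unique w
IsPerm⇒Unique {n} w↭id = Unique-resp-↭ (↭-sym w↭id) (Unique-idPerm n)

∈-idPerm⁻ : ∀ {n a} → a ∈ idPerm n → 1 ≤ a × a ≤ n
∈-idPerm⁻ {n} a∈ with b , b∈ , refl ← ∈-map⁻ suc a∈ = s≤s z≤n , ∈-upTo⁻ b∈

∈-idPerm⁺ : ∀ {n a} → 1 ≤ a → a ≤ n → a ∈ idPerm n
∈-idPerm⁺ {n} {suc a} _ a<n = ∈-map⁺ suc (∈-upTo⁺ a<n)

∈-perm⇔ : ∀ {n w a} → IsPerm n w → a ∈ w ⇔ (1 ≤ a × a ≤ n)
∈-perm⇔ w↭id = mk⇔ (∈-idPerm⁻ ∘ ∈-resp-↭ w↭id) (λ (1≤a , a≤n) → ∈-resp-↭ (↭-sym w↭id) (∈-idPerm⁺ 1≤a a≤n))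

IsPerm⇒length : ∀ {n x} → IsPerm n x → length x ≡ n
IsPerm⇒length {n} x↭id = trans (↭-length x↭id) (length-idPerm n)

IsPerm⇒∈ : ∀ {n x a} → IsPerm n x → 1 ≤ a → a ≤ n → a ∈ x
IsPerm⇒∈ x↭id 1≤a a≤n = from (∈-perm⇔ x↭id) (1≤a , a≤n)

IsPerm⇒≤ : ∀ {n x} → IsPerm n x → All (_≤ n) x
IsPerm⇒≤ x↭id = All.tabulate (proj₂ ∘ to (∈-perm⇔ x↭id))

IsPerm⇒≥1 : ∀ {n x} → IsPerm n x → All (1 ≤_) x
IsPerm⇒≥1 x↭id = All.tabulate (proj₁ ∘ to (∈-perm⇔ x↭id))

applyUpTo-+ : ∀ (f : ℕ → ℕ) m n → applyUpTo f (m + n) ≡ applyUpTo f m ++ applyUpTo (f ∘ (m +_)) n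
applyUpTo-+ f zero n = refl
applyUpTo-+ f (suc m) n = cong (f 0 ∷_) (applyUpTo-+ (f ∘ suc) m n)

idPerm-+ : ∀ m n → idPerm (m + n) ≡ (m ⊕ idPerm m) (idPerm n)
idPerm-+ m n = begin
  map suc (upTo (m + n))                              ≡⟨ map-upTo suc (m + n) ⟩
  applyUpTo suc (m + n)                               ≡⟨ applyUpTo-+ suc m n ⟩
  applyUpTo suc m ++ applyUpTo (suc ∘ (m +_)) n       ≡⟨ cong₂ _++_ (map-upTo suc m) shifted ⟨
  idPerm m ++ map (m +_) (idPerm n)                   ∎
  where
  open ≡-Reasoning
  shifted : map (m +_) (idPerm n) ≡ applyUpTo (suc ∘ (m +_)) n
  shifted = begin
    map (m +_) (map suc (upTo n))   ≡⟨ map-∘ (upTo n) ⟨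
    map ((m +_) ∘ suc) (upTo n)     ≡⟨ map-cong (+-suc m) (upTo n) ⟩
    map (suc ∘ (m +_)) (upTo n)     ≡⟨ map-upTo (suc ∘ (m +_)) n ⟩
    applyUpTo (suc ∘ (m +_)) n      ∎

·-⊕ : ∀ n x y p → length x ≡ n → All (_≢ n) p →
      (n ⊕ x) y · p ≡ (n ⊕ (x · lowPart n p)) (y · highPart n p)
·-⊕ n x y [] _ _ = refl
·-⊕ n x y (k ∷ p) |x|≡n (k≢n ∷ p≢n) with <-cmp k n
... | tri≈ _ k≡n _ = ⊥-elim (k≢n k≡n)
... | tri< k<n _ k≯n
  rewrite filter-accept (_<? n) {k} {p} k<n | filter-reject (n <?_) {k} {p} k≯n
        | swapAt-++ˡ k x (map (n +_) y) (subst (k <_) (sym |x|≡n) k<n)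
  = ·-⊕ n (swapAt k x) y p (trans (↭-length (swapAt-↭ k x)) |x|≡n) p≢n
-- Here k = suc (n + d), which acts on the second block as the letter suc d.
... | tri> k≮n _ n<k with refl ← |x|≡n | d , refl ← m≤n⇒∃[o]m+o≡n n<k
  rewrite filter-reject (_<? length x) {suc (length x + d)} {p} k≮n
        | filter-accept (length x <?_) {suc (length x + d)} {p} n<k
        | swapAt-++ʳ x (map (length x +_) y) d
        | swapAt-map (length x +_) (suc d) y
        | trans (cong (_∸ length x) (sym (+-suc (length x) d))) (m+n∸m≡n (length x) (suc d))
  = ·-⊕ (length x) x (swapAt (suc d) y) p refl p≢n

prod-⊕ : ∀ n₁ n₂ p → All (_≢ n₁) p →
         prod (n₁ + n₂) p ≡ (n₁ ⊕ prod n₁ (lowPart n₁ p)) (prod n₂ (highPart n₁ p))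
prod-⊕ n₁ n₂ p p≢n₁ =
  trans (cong (_· p) (idPerm-+ n₁ n₂)) (·-⊕ n₁ (idPerm n₁) (idPerm n₂) p (length-idPerm n₁) p≢n₁)

swapAt-⊕-junction : ∀ n₁ x y → length x ≡ n₁ → 1 ≤ n₁ → 1 ≤ length y →
                    ∃₂ λ a b → a ∈ x × b ∈ y × Before (swapAt n₁ ((n₁ ⊕ x) y)) (n₁ + b) a
swapAt-⊕-junction n₁ x y |x|≡n₁ 1≤n₁ 1≤|y| with initLast x | y
... | [] | _ = ⊥-elim (<⇒≢ 1≤n₁ |x|≡n₁)
... | _ | [] = ⊥-elim (<-irrefl refl 1≤|y|)
... | x′ ∷ʳ′ a | b ∷ y′ = a , b , ∈-++⁺ʳ x′ (here refl) , here refl ,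
  subst (λ z → Before z (n₁ + b) a) (sym swapped) (Before-++⁺ʳ x′ (Before-head (here refl)))
  where
  open ≡-Reasoning
  swapped : swapAt n₁ ((x′ ∷ʳ a) ++ map (n₁ +_) (b ∷ y′)) ≡ x′ ++ n₁ + b ∷ a ∷ map (n₁ +_) y′
  swapped = begin
    swapAt n₁ ((x′ ∷ʳ a) ++ map (n₁ +_) (b ∷ y′))
      ≡⟨ cong₂ swapAt (trans (sym |x|≡n₁) (trans (length-++ x′) (+-comm _ 1))) (++-assoc x′ [ a ] _) ⟩
    swapAt (suc (length x′)) (x′ ++ a ∷ n₁ + b ∷ map (n₁ +_) y′)
      ≡⟨ swapAt-middle x′ a (n₁ + b) _ ⟩
    x′ ++ n₁ + b ∷ a ∷ map (n₁ +_) y′ ∎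

-- Commutation classes and their prefixes

infix 4 _∼_
_∼_ : List ℕ → List ℕ → Set
_∼_ = Star CommStep

CommStep-sym : ∀ {p q} → CommStep p q → CommStep q p
CommStep-sym (comm l₁ l₂ i j (inj₁ i+2≤j)) = comm l₁ l₂ j i (inj₂ i+2≤j)
CommStep-sym (comm l₁ l₂ i j (inj₂ j+2≤i)) = comm l₁ l₂ j i (inj₁ j+2≤i)

∼-sym : ∀ {p q} → p ∼ q → q ∼ p
∼-sym = Star.reverse CommStep-sym

∼⇒↭ : ∀ {p q} → p ∼ q → p ↭ q
∼⇒↭ ε = ↭-refl
∼⇒↭ (comm l₁ l₂ i j _ ◅ steps) = ↭-trans (++⁺ˡ l₁ (↭-swap i j ↭-refl)) (∼⇒↭ steps)

·-resp-∼ : ∀ w {p q} → p ∼ q → w · p ≡ w · q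
·-resp-∼ w ε = refl
·-resp-∼ w (step ◅ steps) = trans (·-CommStep w step) (·-resp-∼ w steps)

∼-++⁺ˡ : ∀ u {p q} → p ∼ q → u ++ p ∼ u ++ q
∼-++⁺ˡ u = Star.gmap (u ++_) λ { (comm l₁ l₂ i j far) →
  subst₂ CommStep (++-assoc u l₁ _) (++-assoc u l₁ _) (comm (u ++ l₁) l₂ i j far) }

∼-++⁺ʳ : ∀ v {p q} → p ∼ q → p ++ v ∼ q ++ v
∼-++⁺ʳ v = Star.gmap (_++ v) λ { (comm l₁ l₂ i j far) →
  subst₂ CommStep (sym (++-assoc l₁ _ v)) (sym (++-assoc l₁ _ v)) (comm l₁ (l₂ ++ v) i j far) }

∼-++⁺ : ∀ {p p′ q q′} → p ∼ p′ → q ∼ q′ → p ++ q ∼ p′ ++ q′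
∼-++⁺ {p′ = p′} {q = q} p∼p′ q∼q′ = ∼-++⁺ʳ q p∼p′ ◅◅ ∼-++⁺ˡ p′ q∼q′

filter-adjacent : ∀ {P : ℕ → Set} (P? : ∀ x → Dec (P x)) {i j} l → Far i j → Dec (P i) → Dec (P j) →
                  filter P? (i ∷ j ∷ l) ∼ filter P? (j ∷ i ∷ l)
filter-adjacent P? {i} {j} l far (yes Pi) (yes Pj)
  rewrite filter-accept P? {xs = j ∷ l} Pi | filter-accept P? {xs = l} Pj
        | filter-accept P? {xs = i ∷ l} Pj | filter-accept P? {xs = l} Pi = comm [] _ _ _ far ◅ ε
filter-adjacent P? {i} {j} l far (yes Pi) (no ¬Pj)
  rewrite filter-accept P? {xs = j ∷ l} Pi | filter-reject P? {xs = l} ¬Pj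
        | filter-reject P? {xs = i ∷ l} ¬Pj | filter-accept P? {xs = l} Pi = ε
filter-adjacent P? {i} {j} l far (no ¬Pi) (yes Pj)
  rewrite filter-reject P? {xs = j ∷ l} ¬Pi | filter-accept P? {xs = l} Pj
        | filter-accept P? {xs = i ∷ l} Pj | filter-reject P? {xs = l} ¬Pi = ε
filter-adjacent P? {i} {j} l far (no ¬Pi) (no ¬Pj)
  rewrite filter-reject P? {xs = j ∷ l} ¬Pi | filter-reject P? {xs = l} ¬Pj
        | filter-reject P? {xs = i ∷ l} ¬Pj | filter-reject P? {xs = l} ¬Pi = ε

CommStep-filter : ∀ {P : ℕ → Set} (P? : ∀ x → Dec (P x)) {p q} → CommStep p q → filter P? p ∼ filter P? q
CommStep-filter P? (comm l₁ l₂ i j far) = subst₂ _∼_ (sym (filter-++ P? l₁ _)) (sym (filter-++ P? l₁ _))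
  (∼-++⁺ˡ (filter P? l₁) (filter-adjacent P? l₂ far (P? i) (P? j)))

∼-filter : ∀ {P : ℕ → Set} (P? : ∀ x → Dec (P x)) {p q} → p ∼ q → filter P? p ∼ filter P? q
∼-filter P? ε = ε
∼-filter P? (step ◅ steps) = CommStep-filter P? step ◅◅ ∼-filter P? steps

CommStep-map : ∀ {P : ℕ → Set} (f : ℕ → ℕ) → (∀ {i j} → P i → P j → Far i j → Far (f i) (f j)) →
               ∀ {p q} → All P p → CommStep p q → CommStep (map f p) (map f q)
CommStep-map f f-far Pp (comm l₁ l₂ i j far) with Pi ∷ Pj ∷ _ ← Allₚ.++⁻ʳ l₁ Pp =
  subst₂ CommStep (sym (map-++ f l₁ _)) (sym (map-++ f l₁ _))
    (comm (map f l₁) (map f l₂) (f i) (f j) (f-far Pi Pj far))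

∼-map : ∀ {P : ℕ → Set} (f : ℕ → ℕ) → (∀ {i j} → P i → P j → Far i j → Far (f i) (f j)) →
        ∀ {p q} → All P p → p ∼ q → map f p ∼ map f q
∼-map f f-far Pp ε = ε
∼-map f f-far Pp (step ◅ steps) =
  CommStep-map f f-far Pp step ◅ ∼-map f f-far (All-resp-↭ (∼⇒↭ (step ◅ ε)) Pp) steps

Far-+ : ∀ n {i j} → Far i j → Far (n + i) (n + j)
Far-+ n {i} {j} (inj₁ i+2≤j) = inj₁ (subst (_≤ n + j) (sym (+-assoc n i 2)) (+-monoʳ-≤ n i+2≤j))
Far-+ n {i} {j} (inj₂ j+2≤i) = inj₂ (subst (_≤ n + i) (sym (+-assoc n j 2)) (+-monoʳ-≤ n j+2≤i))

Far-∸ : ∀ n {i j} → n < i → n < j → Far i j → Far (i ∸ n) (j ∸ n)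
Far-∸ n {i} {j} n<i _ (inj₁ i+2≤j) = inj₁ (subst (_≤ j ∸ n) (+-∸-comm 2 (<⇒≤ n<i)) (∸-monoˡ-≤ n i+2≤j))
Far-∸ n {i} {j} _ n<j (inj₂ j+2≤i) = inj₂ (subst (_≤ i ∸ n) (+-∸-comm 2 (<⇒≤ n<j)) (∸-monoˡ-≤ n j+2≤i))

Far-across : ∀ {a n c} → a < n → n < c → Far c a
Far-across {a} {c = c} a<n n<c = inj₂ (subst (_≤ c) (+-comm 2 a) (≤-trans (s≤s a<n) n<c))

∼-shift : ∀ n {p q} → p ∼ q → map (n +_) p ∼ map (n +_) q
∼-shift n = ∼-map {P = λ _ → ⊤} (n +_) (λ _ _ → Far-+ n) (All.universal _ _)

∼-lowPart : ∀ n {p q} → p ∼ q → lowPart n p ∼ lowPart n q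
∼-lowPart n = ∼-filter (_<? n)

∼-highPart : ∀ n {p q} → p ∼ q → highPart n p ∼ highPart n q
∼-highPart n {p} p∼q = ∼-map (_∸ n) (Far-∸ n) (all-filter (n <?_) p) (∼-filter (n <?_) p∼q)

∼-commute-past : ∀ {n c} u v → All (_< n) u → n < c → c ∷ u ++ v ∼ u ++ c ∷ v
∼-commute-past [] v [] _ = ε
∼-commute-past {c = c} (a ∷ u) v (a<n ∷ u<n) n<c =
  comm [] (u ++ v) c a (Far-across a<n n<c) ◅ ∼-++⁺ˡ [ a ] (∼-commute-past u v u<n n<c)

∼-swap-blocks : ∀ {n} u v w → All (_< n) u → All (n <_) v → v ++ u ++ w ∼ u ++ v ++ w
∼-swap-blocks u [] w _ _ = ε
∼-swap-blocks u (c ∷ v) w u<n (n<c ∷ n<v) =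
  ∼-++⁺ˡ [ c ] (∼-swap-blocks u v w u<n n<v) ◅◅ ∼-commute-past u (v ++ w) u<n n<c

∼-sort : ∀ n z → All (_≢ n) z → z ∼ lowPart n z ++ filter (n <?_) z
∼-sort n [] _ = ε
∼-sort n (c ∷ z) (c≢n ∷ z≢n) with <-cmp c n
... | tri≈ _ c≡n _ = ⊥-elim (c≢n c≡n)
... | tri< c<n _ c≯n rewrite filter-accept (_<? n) {c} {z} c<n | filter-reject (n <?_) {c} {z} c≯n =
  ∼-++⁺ˡ [ c ] (∼-sort n z z≢n)
... | tri> c≮n _ n<c rewrite filter-reject (_<? n) {c} {z} c≮n | filter-accept (n <?_) {c} {z} n<c =
  ∼-++⁺ˡ [ c ] (∼-sort n z z≢n) ◅◅ ∼-commute-past (lowPart n z) (filter (n <?_) z) (all-filter (_<? n) z) n<c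

map-+-highPart : ∀ n z → map (n +_) (highPart n z) ≡ filter (n <?_) z
map-+-highPart n z = trans (sym (map-∘ (filter (n <?_) z)))
  (map-id-local (All.map (λ n<x → m+[n∸m]≡n (<⇒≤ n<x)) (all-filter (n <?_) z)))

highPart-++ : ∀ n p q → highPart n (p ++ q) ≡ highPart n p ++ highPart n q
highPart-++ n p q = trans (cong (map (_∸ n)) (filter-++ (n <?_) p q)) (map-++ (_∸ n) (filter (n <?_) p) _)

highPart≥1 : ∀ n z → All (1 ≤_) (highPart n z)
highPart≥1 n z = Allₚ.map⁺ (All.map m<n⇒0<n∸m (all-filter (n <?_) z))

map-+>n : ∀ n {p} → All (1 ≤_) p → All (n <_) (map (n +_) p)
map-+>n n p≥1 = Allₚ.map⁺ (All.map (m<m+n n) p≥1)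

lowPart-⊕ : ∀ n {p p′} → All (_< n) p → All (1 ≤_) p′ → lowPart n ((n ⊕ p) p′) ≡ p
lowPart-⊕ n {p} {p′} p<n p′≥1 = begin
  lowPart n (p ++ map (n +_) p′)             ≡⟨ filter-++ (_<? n) p _ ⟩
  lowPart n p ++ lowPart n (map (n +_) p′)   ≡⟨ cong₂ _++_ (filter-all (_<? n) p<n)
                                                 (filter-none (_<? n) (All.map <⇒≯ (map-+>n n p′≥1))) ⟩
  p ++ []                                    ≡⟨ ++-identityʳ p ⟩
  p                                          ∎
  where open ≡-Reasoning

highPart-⊕ : ∀ n {p p′} → All (_< n) p → All (1 ≤_) p′ → highPart n ((n ⊕ p) p′) ≡ p′
highPart-⊕ n {p} {p′} p<n p′≥1 = begin
  highPart n (p ++ map (n +_) p′)                       ≡⟨ highPart-++ n p _ ⟩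
  highPart n p ++ highPart n (map (n +_) p′)            ≡⟨ cong₂ (λ s t → map (_∸ n) s ++ map (_∸ n) t)
                                                            (filter-none (n <?_) (All.map <⇒≯ p<n))
                                                            (filter-all (n <?_) (map-+>n n p′≥1)) ⟩
  map (_∸ n) (map (n +_) p′)                            ≡⟨ map-∘ p′ ⟨
  map (λ a → n + a ∸ n) p′                              ≡⟨ map-id-local (All.universal (m+n∸m≡n n) p′) ⟩
  p′                                                    ∎
  where open ≡-Reasoning

Far? : ∀ i j → Dec (Far i j)
Far? i j = (i + 2 ≤? j) ⊎-dec (j + 2 ≤? i)

headSwap : ∀ x y r → Dec (Far x y) → List (List ℕ)
headSwap x y r (yes _) = [ y ∷ x ∷ r ]
headSwap x y r (no _) = []

commNeighbours : List ℕ → List (List ℕ)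
commNeighbours (x ∷ w@(y ∷ r)) = headSwap x y r (Far? x y) ++ map (x ∷_) (commNeighbours w)
commNeighbours _ = []

CommStep-∷ : ∀ x {w z} → CommStep w z → CommStep (x ∷ w) (x ∷ z)
CommStep-∷ x (comm l₁ l₂ i j far) = comm (x ∷ l₁) l₂ i j far

commNeighbours-sound : ∀ {w z} → z ∈ commNeighbours w → CommStep w z
commNeighbours-sound {x ∷ y ∷ r} z∈ with ∈-++⁻ (headSwap x y r (Far? x y)) z∈
... | inj₁ z∈head = headSwap-sound (Far? x y) z∈head
  where
  headSwap-sound : ∀ {z} (far? : Dec (Far x y)) → z ∈ headSwap x y r far? → CommStep (x ∷ y ∷ r) z
  headSwap-sound (yes far) (here refl) = comm [] r x y far
... | inj₂ z∈tail with z′ , z′∈ , refl ← ∈-map⁻ (x ∷_) z∈tail = CommStep-∷ x (commNeighbours-sound z′∈)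

commNeighbours-complete : ∀ {w z} → CommStep w z → z ∈ commNeighbours w
commNeighbours-complete (comm [] l₂ i j far) = ∈-++⁺ˡ (headSwap-complete (Far? i j))
  where
  headSwap-complete : (far? : Dec (Far i j)) → j ∷ i ∷ l₂ ∈ headSwap i j l₂ far?
  headSwap-complete (yes _) = here refl
  headSwap-complete (no ¬far) = ⊥-elim (¬far far)
commNeighbours-complete (comm (x ∷ []) l₂ i j far) =
  ∈-++⁺ʳ _ (∈-map⁺ (x ∷_) (commNeighbours-complete (comm [] l₂ i j far)))
commNeighbours-complete (comm (x ∷ y ∷ l₁) l₂ i j far) =
  ∈-++⁺ʳ _ (∈-map⁺ (x ∷_) (commNeighbours-complete (comm (y ∷ l₁) l₂ i j far)))

wordsOver : List ℕ → ℕ → List (List ℕ)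
wordsOver L zero = [ [] ]
wordsOver L (suc m) = concatMap (λ a → map (a ∷_) (wordsOver L m)) L

∈-wordsOver : ∀ L z → (∀ {a} → a ∈ z → a ∈ L) → z ∈ wordsOver L (length z)
∈-wordsOver L [] _ = here refl
∈-wordsOver L (a ∷ z) z⊆L =
  ∈-concatMap⁺ (λ a → map (a ∷_) (wordsOver L (length z)))
    (lose (z⊆L (here refl)) (∈-map⁺ (a ∷_) (∈-wordsOver L z (z⊆L ∘ there))))

commClass : ∀ k → Enumeration (k ∼_)
commClass k = enumerateReachable (≡-dec _≟_) commNeighbours commNeighbours-sound commNeighbours-complete
  k (wordsOver k (length k)) λ {j} k∼j →
    subst (λ m → j ∈ wordsOver k m) (sym (↭-length (∼⇒↭ k∼j))) (∈-wordsOver k j (∈-resp-↭ (↭-sym (∼⇒↭ k∼j))))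

∈-inits⁺ : ∀ {A : Set} (p q : List A) → p ∈ inits (p ++ q)
∈-inits⁺ [] q = here refl
∈-inits⁺ (x ∷ p) q = there (∈-map⁺ (x ∷_) (∈-inits⁺ p q))

∈-inits⁻ : ∀ {A : Set} (j : List A) {p} → p ∈ inits j → ∃ λ q → j ≡ p ++ q
∈-inits⁻ j (here refl) = j , refl
∈-inits⁻ (x ∷ j) (there p∈) with p′ , p′∈ , refl ← ∈-map⁻ (x ∷_) p∈ with q , refl ← ∈-inits⁻ j p′∈ = q , refl

preEnumeration : ∀ n k → Enumeration (InPre n k)
preEnumeration n k =
  enumeration (deduplicate (≡-dec _≟_) candidates) (deduplicate-! (≡-dec _≟_) candidates) λ x → mk⇔
  (λ x∈ → candidate⇒InPre (∈-deduplicate⁻ (≡-dec _≟_) candidates x∈))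
  (∈-deduplicate⁺ (≡-dec _≟_) ∘ InPre⇒candidate)
  where
  prefixProducts : List ℕ → List (List ℕ)
  prefixProducts j = map (prod n) (inits j)
  candidates : List (List ℕ)
  candidates = concatMap prefixProducts (list (commClass k))
  candidate⇒InPre : ∀ {x} → x ∈ candidates → InPre n k x
  candidate⇒InPre x∈ with j , j∈ , x∈j ← find (∈-concatMap⁻ prefixProducts {xs = list (commClass k)} x∈)
                      with p , p∈ , refl ← ∈-map⁻ (prod n) x∈j
                      with q , j≡pq ← ∈-inits⁻ j p∈
    = j , ∈⁻ (commClass k) j∈ , p , q , j≡pq , refl
  InPre⇒candidate : ∀ {x} → InPre n k x → x ∈ candidates
  InPre⇒candidate (j , k∼j , p , q , refl , refl) =
    ∈-concatMap⁺ prefixProducts (lose (∈⁺ (commClass k) k∼j) (∈-map⁺ (prod n) (∈-inits⁺ p q)))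

InPre⇒IsPerm : ∀ {n k x} → InPre n k x → IsPerm n x
InPre⇒IsPerm {n} (_ , _ , p , _ , _ , refl) = ·-↭ (idPerm n) p

idPerm∈Pre : ∀ {n k} → InPre n k (idPerm n)
idPerm∈Pre {k = k} = k , ε , [] , k , refl , refl

-- Inversions and the weak order

infix 4 _≤ʷ_
_≤ʷ_ : List ℕ → List ℕ → Set
x ≤ʷ w = ∀ {a b} → InInv x a b → InInv w a b

inversions : List ℕ → List (ℕ × ℕ)
inversions [] = []
inversions (x ∷ r) = map (λ y → y , x) (filter (_<? x) r) ++ inversions r

∈-inversions⁻ : ∀ w {a b} → (a , b) ∈ inversions w → InInv w a b
∈-inversions⁻ (x ∷ r) ab∈ with ∈-++⁻ (map (λ y → y , x) (filter (_<? x) r)) ab∈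
... | inj₂ ab∈r = let a<b , b≺a = ∈-inversions⁻ r ab∈r in a<b , Before-tail b≺a
... | inj₁ ab∈x with _ , a∈ , refl ← ∈-map⁻ (λ y → y , x) ab∈x =
  let a∈r , a<x = ∈-filter⁻ (_<? x) a∈ in a<x , Before-head a∈r

∈-inversions⁺ : ∀ w {a b} → InInv w a b → (a , b) ∈ inversions w
∈-inversions⁺ [] (_ , b≺a) = ⊥-elim (¬Before-[] b≺a)
∈-inversions⁺ (x ∷ r) (a<b , b≺a) with Before-∷⁻ b≺a
... | inj₁ (refl , a∈r) = ∈-++⁺ˡ (∈-map⁺ (λ y → y , x) (∈-filter⁺ (_<? x) a∈r a<b))
... | inj₂ b≺a′ = ∈-++⁺ʳ _ (∈-inversions⁺ r (a<b , b≺a′))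

Unique-inversions : ∀ w → Unique w → Unique (inversions w)
Unique-inversions [] _ = []
Unique-inversions (x ∷ r) (x≢r ∷ r!) =
  Unique.++⁺ (Unique.map⁺ (cong proj₁) (Unique.filter⁺ (_<? x) r!)) (Unique-inversions r r!) disjoint
  where
  disjoint : ∀ {v} → ¬ (v ∈ map (λ y → y , x) (filter (_<? x) r) × v ∈ inversions r)
  disjoint (v∈ , v∈r) with _ , _ , refl ← ∈-map⁻ (λ y → y , x) v∈ =
    All.lookup x≢r (proj₁ (Before⇒∈ (proj₂ (∈-inversions⁻ r v∈r)))) refl

inversionEnumeration : ∀ w → Unique w → Enumeration (λ (p : ℕ × ℕ) → let (a , b) = p in InInv w a b)
inversionEnumeration w w! =
  enumeration (inversions w) (Unique-inversions w w!) λ { (a , b) → mk⇔ (∈-inversions⁻ w) (∈-inversions⁺ w) }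

inversionCount : List ℕ → ℕ
inversionCount w = length (inversions w)

#below : ℕ → List ℕ → ℕ
#below x r = length (filter (_<? x) r)

inversionCount-∷ : ∀ x r → inversionCount (x ∷ r) ≡ #below x r + inversionCount r
inversionCount-∷ x r = trans (length-++ (map (λ y → y , x) (filter (_<? x) r)))
                              (cong (_+ inversionCount r) (length-map _ (filter (_<? x) r)))

#below-↭ : ∀ x {r s} → r ↭ s → #below x r ≡ #below x s
#below-↭ x r↭s = ↭-length (filter-↭ (_<? x) r↭s)

#below-∷ : ∀ x y r → #below x r ≤ #below x (y ∷ r)
#below-∷ x y r with y <? x
... | yes y<x rewrite filter-accept (_<? x) {y} {r} y<x = n≤1+n _
... | no y≮x rewrite filter-reject (_<? x) {y} {r} y≮x = ≤-refl

ascent-inversionCount : ∀ {x y} r → x < y → inversionCount (y ∷ x ∷ r) ≡ suc (inversionCount (x ∷ y ∷ r))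
ascent-inversionCount {x} {y} r x<y
  rewrite inversionCount-∷ y (x ∷ r) | inversionCount-∷ x r
        | inversionCount-∷ x (y ∷ r) | inversionCount-∷ y r
        | filter-accept (_<? y) {x} {r} x<y | filter-reject (_<? x) {y} {r} (<⇒≯ x<y)
  = cong suc (x∙yz≈y∙xz (#below y r) (#below x r) (inversionCount r))

nonascent-inversionCount : ∀ {x y} r → ¬ x < y → inversionCount (y ∷ x ∷ r) ≤ inversionCount (x ∷ y ∷ r)
nonascent-inversionCount {x} {y} r x≮y
  rewrite inversionCount-∷ y (x ∷ r) | inversionCount-∷ x r
        | inversionCount-∷ x (y ∷ r) | inversionCount-∷ y r
        | filter-reject (_<? y) {x} {r} x≮y
  = subst (_≤ #below x (y ∷ r) + (#below y r + inversionCount r))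
          (x∙yz≈y∙xz (#below x r) (#below y r) (inversionCount r))
          (+-monoˡ-≤ _ (#below-∷ x y r))

ascent-≤ʷ : ∀ {x y} r → x < y → x ∷ y ∷ r ≤ʷ y ∷ x ∷ r
ascent-≤ʷ r x<y (a<b , b≺a) with Before-∷⁻ b≺a
... | inj₁ (refl , here refl) = ⊥-elim (<-asym a<b x<y)
... | inj₁ (refl , there a∈r) = a<b , Before-tail (Before-head a∈r)
... | inj₂ b≺a′ with Before-∷⁻ b≺a′
...   | inj₁ (refl , a∈r) = a<b , Before-head (there a∈r)
...   | inj₂ b≺a″ = a<b , Before-tail (Before-tail b≺a″)

swapAt-inversionCount : ∀ k w →
  inversionCount (swapAt k w) ≤ inversionCount w ⊎
  (inversionCount (swapAt k w) ≡ suc (inversionCount w) × w ≤ʷ swapAt k w)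
swapAt-inversionCount (suc zero) (x ∷ y ∷ r) with x <? y
... | yes x<y = inj₂ (ascent-inversionCount r x<y , ascent-≤ʷ r x<y)
... | no x≮y = inj₁ (nonascent-inversionCount r x≮y)
swapAt-inversionCount (suc (suc k)) (x ∷ r)
  rewrite inversionCount-∷ x (swapAt (suc k) r) | inversionCount-∷ x r | #below-↭ x (swapAt-↭ (suc k) r)
  with swapAt-inversionCount (suc k) r
... | inj₁ ≤inv = inj₁ (+-monoʳ-≤ (#below x r) ≤inv)
... | inj₂ (≡suc , r≤ʷ) = inj₂ (trans (cong (#below x r +_) ≡suc) (+-suc _ _) , x∷r≤ʷ)
  where
  x∷r≤ʷ : x ∷ r ≤ʷ x ∷ swapAt (suc k) r
  x∷r≤ʷ (a<b , b≺a) with Before-∷⁻ b≺a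
  ... | inj₁ (refl , a∈r) = a<b , Before-head (∈-resp-↭ (↭-sym (swapAt-↭ (suc k) r)) a∈r)
  ... | inj₂ b≺a′ = a<b , Before-tail (proj₂ (r≤ʷ (a<b , b≺a′)))
swapAt-inversionCount zero _ = inj₁ ≤-refl
swapAt-inversionCount (suc zero) [] = inj₁ ≤-refl
swapAt-inversionCount (suc zero) (_ ∷ []) = inj₁ ≤-refl
swapAt-inversionCount (suc (suc k)) [] = inj₁ ≤-refl

inversionCount-· : ∀ w q → inversionCount (w · q) ≤ inversionCount w + length q
inversionCount-· w [] = ≤-reflexive (sym (+-identityʳ _))
inversionCount-· w (k ∷ q) with swapAt-inversionCount k w
... | inj₁ ≤inv = ≤-trans (inversionCount-· (swapAt k w) q) (+-mono-≤ ≤inv (n≤1+n (length q)))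
... | inj₂ (≡suc , _) = ≤-trans (inversionCount-· (swapAt k w) q)
                                (≤-reflexive (trans (cong (_+ length q) ≡suc) (sym (+-suc _ _))))

-- Every letter of q adds at most one inversion; if all of them do, no inversion is ever undone.
inversionCount-·-tight : ∀ w q → inversionCount (w · q) ≡ inversionCount w + length q → w ≤ʷ w · q
inversionCount-·-tight w [] _ ab = ab
inversionCount-·-tight w (k ∷ q) tight with swapAt-inversionCount k w
... | inj₁ ≤inv = ⊥-elim (<⇒≱ (≤-reflexive (sym (trans tight (+-suc _ _))))
                     (≤-trans (inversionCount-· (swapAt k w) q) (+-monoˡ-≤ (length q) ≤inv)))
... | inj₂ (≡suc , w≤ʷ) = inversionCount-·-tight (swapAt k w) q
                            (trans tight (trans (+-suc _ _) (cong (_+ length q) (sym ≡suc)))) ∘ w≤ʷ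

inversionCount-applyUpTo : ∀ (f : ℕ → ℕ) n → (∀ {i j} → i < j → f i < f j) →
                           inversionCount (applyUpTo f n) ≡ 0
inversionCount-applyUpTo f zero _ = refl
inversionCount-applyUpTo f (suc n) f-mono = begin
  inversionCount (f 0 ∷ applyUpTo (f ∘ suc) n)
    ≡⟨ inversionCount-∷ (f 0) (applyUpTo (f ∘ suc) n) ⟩
  #below (f 0) (applyUpTo (f ∘ suc) n) + inversionCount (applyUpTo (f ∘ suc) n)
    ≡⟨ cong₂ _+_ (cong length (filter-none (_<? f 0) none-below))
                 (inversionCount-applyUpTo (f ∘ suc) n (f-mono ∘ s<s)) ⟩
  0                                                                       ∎
  where
  open ≡-Reasoning
  none-below : All (λ y → ¬ y < f 0) (applyUpTo (f ∘ suc) n)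
  none-below = Allₚ.applyUpTo⁺₂ (f ∘ suc) n (λ i → <⇒≯ (f-mono z<s))

inversionCount-idPerm : ∀ n → inversionCount (idPerm n) ≡ 0
inversionCount-idPerm n = trans (cong inversionCount (map-upTo suc n)) (inversionCount-applyUpTo suc n s<s)

inversionCount-prod : ∀ n p → inversionCount (prod n p) ≤ length p
inversionCount-prod n p = subst (inversionCount (prod n p) ≤_) (cong (_+ length p) (inversionCount-idPerm n))
  (inversionCount-· (idPerm n) p)

-- A prefix of a reduced word is reduced, so it stays below w in the weak order.
InPre⇒≤ʷ : ∀ {n w i x} → IsReducedWord n w i → InPre n i x → x ≤ʷ w
InPre⇒≤ʷ {n} {w} {i} (_ , prod-i≡w , i-card) (_ , i∼pq , p , q , refl , refl) =
  subst (prod n p ≤ʷ_) prod-p·q≡w (inversionCount-·-tight (prod n p) q tight)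
  where
  prod-p·q≡w : prod n p · q ≡ w
  prod-p·q≡w = trans (sym (·-++ (idPerm n) p q)) (trans (sym (·-resp-∼ (idPerm n) i∼pq)) prod-i≡w)
  |i|≡inv : length i ≡ inversionCount w
  |i|≡inv = to (HasCard⇔≡size (inversionEnumeration w w!)) i-card
    where w! = subst Unique prod-i≡w (IsPerm⇒Unique (·-↭ (idPerm n) i))
  total : inversionCount (prod n p · q) ≡ length p + length q
  total = trans (cong inversionCount prod-p·q≡w)
            (trans (sym |i|≡inv) (trans (↭-length (∼⇒↭ i∼pq)) (length-++ p)))
  tight : inversionCount (prod n p · q) ≡ inversionCount (prod n p) + length q
  tight = ≤-antisym (inversionCount-· (prod n p) q)
            (subst (inversionCount (prod n p) + length q ≤_) (sym total)
                   (+-monoˡ-≤ (length q) (inversionCount-prod n p)))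

-- Relative order in a direct sum

∈-map-+⇒> : ∀ n {y a} → All (1 ≤_) y → a ∈ map (n +_) y → n < a
∈-map-+⇒> n y≥1 a∈ with b , b∈y , refl ← ∈-map⁻ (n +_) a∈ = m<m+n n (All.lookup y≥1 b∈y)

module _ (n₁ : ℕ) {x y : List ℕ} where

  Before-⊕ˡ : ∀ {a b} → All (1 ≤_) y → a ≤ n₁ → b ≤ n₁ → Before ((n₁ ⊕ x) y) a b ⇔ Before x a b
  Before-⊕ˡ y≥1 a≤n₁ b≤n₁ = mk⇔ from-⊕ (Before-++⁺ˡ _)
    where
    from-⊕ : Before ((n₁ ⊕ x) y) _ _ → Before x _ _
    from-⊕ a≺b with Before-++⁻ x a≺b
    ... | inj₁ a≺b′ = a≺b′
    ... | inj₂ (inj₁ (_ , b∈)) = ⊥-elim (<⇒≱ (∈-map-+⇒> n₁ y≥1 b∈) b≤n₁)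
    ... | inj₂ (inj₂ a≺b′) = ⊥-elim (<⇒≱ (∈-map-+⇒> n₁ y≥1 (proj₁ (Before⇒∈ a≺b′))) a≤n₁)

  Before-⊕ʳ : ∀ {a b} → All (_≤ n₁) x → 1 ≤ a → Before ((n₁ ⊕ x) y) (n₁ + a) (n₁ + b) ⇔ Before y a b
  Before-⊕ʳ x≤n₁ 1≤a = mk⇔ from-⊕ (Before-++⁺ʳ x ∘ Before-map⁺ (n₁ +_))
    where
    n₁+a∉x : ¬ (n₁ + _ ∈ x)
    n₁+a∉x n₁+a∈x = <⇒≱ (m<m+n n₁ 1≤a) (All.lookup x≤n₁ n₁+a∈x)
    from-⊕ : Before ((n₁ ⊕ x) y) (n₁ + _) (n₁ + _) → Before y _ _
    from-⊕ a≺b with Before-++⁻ x a≺b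
    ... | inj₁ a≺b′ = ⊥-elim (n₁+a∉x (proj₁ (Before⇒∈ a≺b′)))
    ... | inj₂ (inj₁ (a∈ , _)) = ⊥-elim (n₁+a∉x a∈)
    ... | inj₂ (inj₂ a≺b′) = Before-map⁻ (+-cancelˡ-≡ n₁ _ _) a≺b′

  Before-⊕-across : ∀ {a b} → a ∈ x → b ∈ y → Before ((n₁ ⊕ x) y) a (n₁ + b)
  Before-⊕-across a∈x b∈y = Before-++-across a∈x (∈-map⁺ (n₁ +_) b∈y)

  ¬Before-⊕-down : ∀ {a b} → All (_≤ n₁) x → All (1 ≤_) y → n₁ < a → b ≤ n₁ → ¬ Before ((n₁ ⊕ x) y) a b
  ¬Before-⊕-down x≤n₁ y≥1 n₁<a b≤n₁ a≺b with Before-++⁻ x a≺b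
  ... | inj₁ a≺b′ = <⇒≱ n₁<a (All.lookup x≤n₁ (proj₁ (Before⇒∈ a≺b′)))
  ... | inj₂ (inj₁ (a∈x , _)) = <⇒≱ n₁<a (All.lookup x≤n₁ a∈x)
  ... | inj₂ (inj₂ a≺b′) = <⇒≱ (∈-map-+⇒> n₁ y≥1 (proj₂ (Before⇒∈ a≺b′))) b≤n₁

  InInv-⊕ˡ : ∀ {a b} → All (1 ≤_) y → a ≤ n₁ → b ≤ n₁ → InInv ((n₁ ⊕ x) y) a b ⇔ InInv x a b
  InInv-⊕ˡ y≥1 a≤n₁ b≤n₁ = ⇔-refl ×-⇔ Before-⊕ˡ y≥1 b≤n₁ a≤n₁

  InInv-⊕ʳ : ∀ {a b} → All (_≤ n₁) x → 1 ≤ b → InInv ((n₁ ⊕ x) y) (n₁ + a) (n₁ + b) ⇔ InInv y a b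
  InInv-⊕ʳ x≤n₁ 1≤b = mk⇔ (+-cancelˡ-< n₁ _ _) (+-monoʳ-< n₁) ×-⇔ Before-⊕ʳ x≤n₁ 1≤b

-- The majority relation of one commutation class

x+y<2x⇔y<x : ∀ x y → x + y < 2 * x ⇔ y < x
x+y<2x⇔y<x x y rewrite +-identityʳ x = mk⇔ (+-cancelˡ-< x y x) (+-monoʳ-< x)

x+y≤2y⇔x≤y : ∀ x y → x + y ≤ 2 * y ⇔ x ≤ y
x+y≤2y⇔x≤y x y rewrite +-identityʳ y = mk⇔ (+-cancelʳ-≤ y x y) (+-monoˡ-≤ y)

x*m<y*m⇔x<y : ∀ {x y m} → 1 ≤ m → x * m < y * m ⇔ x < y
x*m<y*m⇔x<y {x} {y} {suc m} _ = mk⇔ (*-cancelʳ-< (suc m) x y) (*-monoˡ-< (suc m))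

m*x<m*y⇔x<y : ∀ {x y m} → 1 ≤ m → m * x < m * y ⇔ x < y
m*x<m*y⇔x<y {x} {y} {suc m} _ = mk⇔ (*-cancelˡ-< (suc m) x y) (*-monoʳ-< (suc m))

module Counting {n k} (E : Enumeration (InPre n k)) where

  #before : ℕ → ℕ → ℕ
  #before a b = size (filterᴱ E (λ x → Before? x a b))

  Majority⇔#before : ∀ a b → Majority n k a b ⇔ #before b a < #before a b
  Majority⇔#before a b =
    HasCard₂⇔ (filterᴱ E (λ x → Before? x a b)) (filterᴱ E (λ x → Before? x b a)) (λ k₁ k₂ → k₂ < k₁)

  size≥1 : 1 ≤ size E
  size≥1 = ∈⇒1≤length (∈⁺ E idPerm∈Pre)

  #before-complement : ∀ {a b} → a ≢ b → 1 ≤ a → a ≤ n → 1 ≤ b → b ≤ n → #before a b + #before b a ≡ size E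
  #before-complement a≢b 1≤a a≤n 1≤b b≤n =
    length-filter-partition (λ x → Before? x _ _) (λ x → Before? x _ _) (list E) λ x∈ →
      let x-perm = InPre⇒IsPerm (∈⁻ E x∈) in
      Before-total (IsPerm⇒∈ x-perm 1≤a a≤n) (IsPerm⇒∈ x-perm 1≤b b≤n) a≢b ,
      λ (a≺b , b≺a) → Before-asym (IsPerm⇒Unique x-perm) a≺b b≺a

  #before≡0 : ∀ {a b} → (∀ {x} → InPre n k x → ¬ Before x a b) → #before a b ≡ 0
  #before≡0 never = cong length (filter-none (λ x → Before? x _ _) (All.tabulate (never ∘ ∈⁻ E)))

module _ {n : ℕ} {k : List ℕ} where
  open Counting (preEnumeration n k)

  Majority? : ∀ a b → Dec (Majority n k a b)
  Majority? a b = Dec.map (⇔-sym (Majority⇔#before a b)) (#before b a <? #before a b)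

  Majority-asym : ∀ {a b} → Majority n k a b → ¬ Majority n k b a
  Majority-asym {a} {b} ab ba = <-asym (to (Majority⇔#before a b) ab) (to (Majority⇔#before b a) ba)

  Majority-unanimous : ∀ {a b} → a ≢ b → 1 ≤ a → a ≤ n → 1 ≤ b → b ≤ n →
                       (∀ {x} → InPre n k x → ¬ Before x b a) → Majority n k a b
  Majority-unanimous {a} {b} a≢b 1≤a a≤n 1≤b b≤n never =
    from (Majority⇔#before a b) (subst₂ _<_ (sym none) (sym all) size≥1)
    where
    none : #before b a ≡ 0
    none = #before≡0 never
    all : #before a b ≡ size (preEnumeration n k)
    all = trans (sym (+-identityʳ _))
                (trans (cong (#before a b +_) (sym none)) (#before-complement a≢b 1≤a a≤n 1≤b b≤n))

  module _ {a b} (1≤a : 1 ≤ a) (a<b : a < b) (b≤n : b ≤ n) where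

    private
      1≤b = ≤-trans 1≤a (<⇒≤ a<b)
      a≤n = ≤-trans (<⇒≤ a<b) b≤n
      s = size (preEnumeration n k)

      inversionsᴱ : Enumeration (λ x → InPre n k x × InInv x a b)
      inversionsᴱ = respᴱ (filterᴱ (preEnumeration n k) (λ x → Before? x b a))
        λ x → mk⇔ (λ (x∈ , b≺a) → x∈ , a<b , b≺a) (λ (x∈ , _ , b≺a) → x∈ , b≺a)

    TallyGt⇔Majority : TallyGt n k a b ⇔ Majority n k b a
    TallyGt⇔Majority = begin
      TallyGt n k a b                             ≈⟨ HasCard₂⇔ (preEnumeration n k) inversionsᴱ (λ s t → s < 2 * t) ⟩
      s < 2 * #before b a                         ≡⟨ cong (_< 2 * #before b a) s≡ ⟨
      #before b a + #before a b < 2 * #before b a ≈⟨ x+y<2x⇔y<x (#before b a) (#before a b) ⟩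
      #before a b < #before b a                   ≈⟨ Majority⇔#before b a ⟨
      Majority n k b a                            ∎
      where
      open ⇔-Reasoning
      s≡ = #before-complement (>⇒≢ a<b) 1≤b b≤n 1≤a a≤n

    TallyGe⇔¬Majority : TallyGe n k a b ⇔ (¬ Majority n k a b)
    TallyGe⇔¬Majority = begin
      TallyGe n k a b                             ≈⟨ HasCard₂⇔ (preEnumeration n k) inversionsᴱ (λ s t → s ≤ 2 * t) ⟩
      s ≤ 2 * #before b a                         ≡⟨ cong (_≤ 2 * #before b a) s≡ ⟨
      #before a b + #before b a ≤ 2 * #before b a ≈⟨ x+y≤2y⇔x≤y (#before a b) (#before b a) ⟩
      #before a b ≤ #before b a                   ≈⟨ mk⇔ ≤⇒≯ ≮⇒≥ ⟩
      (¬ (#before b a < #before a b))             ≈⟨ ¬-cong-⇔ (Majority⇔#before a b) ⟨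
      (¬ Majority n k a b)                        ∎
      where
      open ⇔-Reasoning
      s≡ = #before-complement (<⇒≢ a<b) 1≤a a≤n 1≤b b≤n

module _ {n k w u v} (Pre≤ʷw : ∀ {x} → InPre n k x → x ≤ʷ w) (u∈ : InPre n k u) (v∈ : InPre n k v)
         (u-inv : ∀ a b → InInv u a b ⇔ (InInv w a b × TallyGt n k a b))
         (v-inv : ∀ a b → InInv v a b ⇔ (InInv w a b × TallyGe n k a b)) where

  private
    InInv? : ∀ x a b → Dec (InInv x a b)
    InInv? x a b = (a <? b) ×-dec Before? x b a

    nonInversion⇒Majority : ∀ {a b} → 1 ≤ a → a < b → b ≤ n → ¬ InInv w a b → Majority n k a b
    nonInversion⇒Majority 1≤a a<b b≤n ¬inv =
      Majority-unanimous (<⇒≢ a<b) 1≤a (≤-trans (<⇒≤ a<b) b≤n) (≤-trans 1≤a (<⇒≤ a<b)) b≤n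
        (λ x∈ b≺a → ¬inv (Pre≤ʷw x∈ (a<b , b≺a)))

    Before⇔¬Before : ∀ {x a b} → InPre n k x → a ≢ b → 1 ≤ a → a ≤ n → 1 ≤ b → b ≤ n →
                     Before x a b ⇔ (¬ Before x b a)
    Before⇔¬Before x∈ a≢b 1≤a a≤n 1≤b b≤n = mk⇔ (Before-asym (IsPerm⇒Unique x-perm)) λ ¬b≺a →
      [ id , ⊥-elim ∘ ¬b≺a ]′ (Before-total (IsPerm⇒∈ x-perm 1≤a a≤n) (IsPerm⇒∈ x-perm 1≤b b≤n) a≢b)
      where x-perm = InPre⇒IsPerm x∈

  Majority⇔Before-both : ∀ {a b} → 1 ≤ a → a ≤ n → 1 ≤ b → b ≤ n →
                         Majority n k a b ⇔ (Before u a b × Before v a b)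
  Majority⇔Before-both {a} {b} 1≤a a≤n 1≤b b≤n with <-cmp a b
  ... | tri≈ _ refl _ = mk⇔ (λ aa → ⊥-elim (Majority-asym aa aa))
                            (λ (a≺a , _) → ⊥-elim (Before-asym (IsPerm⇒Unique (InPre⇒IsPerm u∈)) a≺a a≺a))
  ... | tri< a<b _ _ = mk⇔
    (λ ab → from u-order (λ b≺a → Majority-asym ab (u-majority b≺a)) , from v-order (λ b≺a → v-minority b≺a ab))
    (λ (_ , a≺b) → majority (to v-order a≺b))
    where
    u-order = Before⇔¬Before u∈ (<⇒≢ a<b) 1≤a a≤n 1≤b b≤n
    v-order = Before⇔¬Before v∈ (<⇒≢ a<b) 1≤a a≤n 1≤b b≤n
    u-majority : Before u b a → Majority n k b a
    u-majority b≺a = to (TallyGt⇔Majority 1≤a a<b b≤n) (proj₂ (to (u-inv a b) (a<b , b≺a)))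
    v-minority : Before v b a → ¬ Majority n k a b
    v-minority b≺a = to (TallyGe⇔¬Majority 1≤a a<b b≤n) (proj₂ (to (v-inv a b) (a<b , b≺a)))
    majority : ¬ Before v b a → Majority n k a b
    majority ¬b≺a with InInv? w a b
    ... | no ¬inv = nonInversion⇒Majority 1≤a a<b b≤n ¬inv
    ... | yes inv = decidable-stable (Majority? a b) λ ¬ab →
      ¬b≺a (proj₂ (from (v-inv a b) (inv , from (TallyGe⇔¬Majority 1≤a a<b b≤n) ¬ab)))
  ... | tri> _ _ b<a = mk⇔
    (λ ab → proj₂ (from (u-inv b a) (inversion ab , from (TallyGt⇔Majority 1≤b b<a a≤n) ab)) ,
            proj₂ (from (v-inv b a) (inversion ab , from (TallyGe⇔¬Majority 1≤b b<a a≤n) (Majority-asym ab))))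
    (λ (a≺b , _) → to (TallyGt⇔Majority 1≤b b<a a≤n) (proj₂ (to (u-inv b a) (b<a , a≺b))))
    where
    inversion : Majority n k a b → InInv w b a
    inversion ab = decidable-stable (InInv? w b a) (Majority-asym ab ∘ nonInversion⇒Majority 1≤b b<a a≤n)

-- Direct sums

m<m+n⇒0<n : ∀ m {n} → m < m + n → 0 < n
m<m+n⇒0<n zero 0<n = 0<n
m<m+n⇒0<n (suc m) (s≤s m<m+n) = m<m+n⇒0<n m m<m+n

module DirectSum {n₁ n₂ w₁ w₂ i} (w₁-perm : IsPerm n₁ w₁) (w₂-perm : IsPerm n₂ w₂)
                 (i-reduced : IsReducedWord (n₁ + n₂) ((n₁ ⊕ w₁) w₂) i) where

  private
    N = n₁ + n₂
    i₁ = lowPart n₁ i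
    i₂ = highPart n₁ i

    junction-inversion : ∀ p → All (_≢ n₁) p → 1 ≤ n₁ → 1 ≤ n₂ →
                         ∃₂ λ a b → a ≤ n₁ × 1 ≤ b × InInv (prod N (p ++ [ n₁ ])) a (n₁ + b)
    junction-inversion p p≢n₁ 1≤n₁ 1≤n₂
      with a , b , a∈x , b∈y , b≺a ← swapAt-⊕-junction n₁ (prod n₁ (lowPart n₁ p)) (prod n₂ (highPart n₁ p))
               (length-prod n₁ (lowPart n₁ p)) 1≤n₁ (subst (1 ≤_) (sym (length-prod n₂ (highPart n₁ p))) 1≤n₂)
      with a≤n₁ ← All.lookup (IsPerm⇒≤ (·-↭ (idPerm n₁) (lowPart n₁ p))) a∈x
      with 1≤b ← All.lookup (IsPerm⇒≥1 (·-↭ (idPerm n₂) (highPart n₁ p))) b∈y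
      = a , b , a≤n₁ , 1≤b , ≤-<-trans a≤n₁ (m<m+n n₁ 1≤b) , subst (λ z → Before z (n₁ + b) a) (sym prod≡) b≺a
      where
      prod≡ : prod N (p ++ [ n₁ ]) ≡ swapAt n₁ ((n₁ ⊕ prod n₁ (lowPart n₁ p)) (prod n₂ (highPart n₁ p)))
      prod≡ = trans (·-++ (idPerm N) p [ n₁ ]) (cong (swapAt n₁) (prod-⊕ n₁ n₂ p p≢n₁))

    -- Prefixes of words in the class stay below w₁ ⊕ w₂, which has no inversion across the two blocks.
    no-first-junction-letter : ∀ {j} p q → i ∼ j → j ≡ p ++ n₁ ∷ q → All (_≢ n₁) p → ⊥
    no-first-junction-letter {j} p q i∼j refl p≢n₁
      with 1≤n₁ , n₁<N ← All.lookup (All-resp-↭ (∼⇒↭ i∼j) (proj₁ i-reduced)) (∈-++⁺ʳ p (here refl))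
      with a , b , a≤n₁ , 1≤b , inversion ← junction-inversion p p≢n₁ 1≤n₁ (m<m+n⇒0<n n₁ n₁<N)
      = ¬Before-⊕-down n₁ (IsPerm⇒≤ w₁-perm) (IsPerm⇒≥1 w₂-perm) (m<m+n n₁ 1≤b) a≤n₁
          (proj₂ (InPre⇒≤ʷ i-reduced (j , i∼j , p ++ [ n₁ ] , q , sym (++-assoc p [ n₁ ] q) , refl) inversion))

  no-junction-letter : ∀ {j} → i ∼ j → All (_≢ n₁) j
  no-junction-letter {j} i∼j with First.first (λ c → Sum.swap (Dec.toSum (c ≟ n₁))) j
  ... | inj₂ j≢n₁ = j≢n₁
  ... | inj₁ first-n₁ with p≢n₁ First.++ refl ∷ q ← toView first-n₁ =
    ⊥-elim (no-first-junction-letter _ q i∼j refl p≢n₁)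

  InPre-⊕⁻ : ∀ {v} → InPre N i v → ∃₂ λ x y → InPre n₁ i₁ x × InPre n₂ i₂ y × v ≡ (n₁ ⊕ x) y
  InPre-⊕⁻ (j , i∼j , p , q , refl , refl) =
    prod n₁ (lowPart n₁ p) , prod n₂ (highPart n₁ p) ,
    (lowPart n₁ (p ++ q) , ∼-lowPart n₁ i∼j , lowPart n₁ p , lowPart n₁ q , filter-++ (_<? n₁) p q , refl) ,
    (highPart n₁ (p ++ q) , ∼-highPart n₁ i∼j , highPart n₁ p , highPart n₁ q , highPart-++ n₁ p q , refl) ,
    prod-⊕ n₁ n₂ p (Allₚ.++⁻ˡ p (no-junction-letter i∼j))

  InPre-⊕⁺ : ∀ {x y} → InPre n₁ i₁ x → InPre n₂ i₂ y → InPre N i ((n₁ ⊕ x) y)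
  InPre-⊕⁺ (j₁ , i₁∼j₁ , p₁ , q₁ , refl , refl) (j₂ , i₂∼j₂ , p₂ , q₂ , refl , refl) =
    _ , i∼ , p₁ ++ ↑ p₂ , q₁ ++ ↑ q₂ , sym (++-assoc p₁ _ _) , sym prod-prefix
    where
    ↑ = map (n₁ +_)
    p₁q₁<n₁ : All (_< n₁) (p₁ ++ q₁)
    p₁q₁<n₁ = All-resp-↭ (∼⇒↭ i₁∼j₁) (all-filter (_<? n₁) i)
    p₁<n₁ = Allₚ.++⁻ˡ p₁ p₁q₁<n₁
    p₂≥1 : All (1 ≤_) p₂
    p₂≥1 = Allₚ.++⁻ˡ p₂ (All-resp-↭ (∼⇒↭ i₂∼j₂) (highPart≥1 n₁ i))
    i∼ : i ∼ p₁ ++ ↑ p₂ ++ q₁ ++ ↑ q₂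
    i∼ = begin
      i                           ⟶*⟨ ∼-sort n₁ i (no-junction-letter ε) ⟩
      i₁ ++ filter (n₁ <?_) i     ≡⟨ cong (i₁ ++_) (map-+-highPart n₁ i) ⟨
      i₁ ++ ↑ i₂                  ⟶*⟨ ∼-++⁺ i₁∼j₁ (∼-shift n₁ i₂∼j₂) ⟩
      (p₁ ++ q₁) ++ ↑ (p₂ ++ q₂)  ≡⟨ trans (++-assoc p₁ q₁ _) (cong (λ t → p₁ ++ q₁ ++ t) (map-++ (n₁ +_) p₂ q₂)) ⟩
      p₁ ++ q₁ ++ ↑ p₂ ++ ↑ q₂    ⟶*⟨ ∼-++⁺ˡ p₁ (∼-sym (∼-swap-blocks q₁ (↑ p₂) (↑ q₂) q₁<n₁ (map-+>n n₁ p₂≥1))) ⟩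
      p₁ ++ ↑ p₂ ++ q₁ ++ ↑ q₂    ∎
      where
      open StarReasoning CommStep
      q₁<n₁ = Allₚ.++⁻ʳ p₁ p₁q₁<n₁
    prod-prefix : prod N (p₁ ++ ↑ p₂) ≡ (n₁ ⊕ prod n₁ p₁) (prod n₂ p₂)
    prod-prefix = trans (prod-⊕ n₁ n₂ (p₁ ++ ↑ p₂) (Allₚ.++⁺ (All.map <⇒≢ p₁<n₁) (All.map >⇒≢ (map-+>n n₁ p₂≥1))))
      (cong₂ (λ s t → (n₁ ⊕ prod n₁ s) (prod n₂ t)) (lowPart-⊕ n₁ p₁<n₁ p₂≥1) (highPart-⊕ n₁ p₁<n₁ p₂≥1))

  Pre₁≤ʷw₁ : ∀ {x} → InPre n₁ i₁ x → x ≤ʷ w₁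
  Pre₁≤ʷw₁ x∈ ab@(_ , b≺a) = to (InInv-⊕ˡ n₁ (IsPerm⇒≥1 w₂-perm) a≤n₁ b≤n₁)
    (InPre⇒≤ʷ i-reduced (InPre-⊕⁺ x∈ idPerm∈Pre) (from (InInv-⊕ˡ n₁ (IsPerm⇒≥1 ↭-refl) a≤n₁ b≤n₁) ab))
    where
    a≤n₁ = All.lookup (IsPerm⇒≤ (InPre⇒IsPerm x∈)) (proj₂ (Before⇒∈ b≺a))
    b≤n₁ = All.lookup (IsPerm⇒≤ (InPre⇒IsPerm x∈)) (proj₁ (Before⇒∈ b≺a))

  Pre₂≤ʷw₂ : ∀ {y} → InPre n₂ i₂ y → y ≤ʷ w₂
  Pre₂≤ʷw₂ y∈ ab@(_ , b≺a) = to (InInv-⊕ʳ n₁ (IsPerm⇒≤ w₁-perm) 1≤b)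
    (InPre⇒≤ʷ i-reduced (InPre-⊕⁺ idPerm∈Pre y∈) (from (InInv-⊕ʳ n₁ (IsPerm⇒≤ ↭-refl) 1≤b) ab))
    where
    1≤b = All.lookup (IsPerm⇒≥1 (InPre⇒IsPerm y∈)) (proj₁ (Before⇒∈ b≺a))

  Before-⊕-Pre-across : ∀ {x y a b} → InPre n₁ i₁ x → InPre n₂ i₂ y → 1 ≤ a → a ≤ n₁ → 1 ≤ b → b ≤ n₂ →
                        Before ((n₁ ⊕ x) y) a (n₁ + b)
  Before-⊕-Pre-across x∈ y∈ 1≤a a≤n₁ 1≤b b≤n₂ =
    Before-⊕-across n₁ (IsPerm⇒∈ (InPre⇒IsPerm x∈) 1≤a a≤n₁) (IsPerm⇒∈ (InPre⇒IsPerm y∈) 1≤b b≤n₂)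

  private
    E₁ = preEnumeration n₁ i₁
    E₂ = preEnumeration n₂ i₂
    module C₁ = Counting E₁
    module C₂ = Counting E₂

    ⊕-injˡ : ∀ {x x′ y y′} → x ∈ list E₁ → x′ ∈ list E₁ → (n₁ ⊕ x) y ≡ (n₁ ⊕ x′) y′ → x ≡ x′
    ⊕-injˡ x∈ x′∈ = ++-cancel-sameLength _ _ (trans (|E₁| x∈) (sym (|E₁| x′∈)))
      where
      |E₁| : ∀ {z} → z ∈ list E₁ → length z ≡ n₁
      |E₁| = IsPerm⇒length ∘ InPre⇒IsPerm ∘ ∈⁻ E₁

    ⊕-injʳ : ∀ {x y y′} → (n₁ ⊕ x) y ≡ (n₁ ⊕ x) y′ → y ≡ y′
    ⊕-injʳ {x} eq = map-injective (+-cancelˡ-≡ n₁ _ _) (++-cancelˡ x _ _ eq)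

    ∈-⊕-product⇔ : ∀ v → v ∈ cartesianProductWith (n₁ ⊕_) (list E₁) (list E₂) ⇔ InPre N i v
    ∈-⊕-product⇔ v = mk⇔ from-product to-product
      where
      from-product : v ∈ cartesianProductWith (n₁ ⊕_) (list E₁) (list E₂) → InPre N i v
      from-product v∈ with _ , _ , x∈ , y∈ , refl ← ∈-cartesianProductWith⁻ (n₁ ⊕_) _ _ v∈ =
        InPre-⊕⁺ (∈⁻ E₁ x∈) (∈⁻ E₂ y∈)
      to-product : InPre N i v → v ∈ cartesianProductWith (n₁ ⊕_) (list E₁) (list E₂)
      to-product v∈ with x , y , x∈ , y∈ , refl ← InPre-⊕⁻ v∈ =
        ∈-cartesianProductWith⁺ (n₁ ⊕_) (∈⁺ E₁ x∈) (∈⁺ E₂ y∈)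

  preEnumeration-⊕ : Enumeration (InPre N i)
  preEnumeration-⊕ = enumeration (cartesianProductWith (n₁ ⊕_) (list E₁) (list E₂))
    (Unique-cartesianProductWith (n₁ ⊕_) ⊕-injˡ ⊕-injʳ (unique E₁) (unique E₂)) ∈-⊕-product⇔

  open Counting preEnumeration-⊕ using (#before; Majority⇔#before)

  #before-⊕ˡ : ∀ {a b} → a ≤ n₁ → b ≤ n₁ → #before a b ≡ C₁.#before a b * size E₂
  #before-⊕ˡ {a} {b} a≤n₁ b≤n₁ =
    length-filter-cartesianProductWithˡ (n₁ ⊕_) (λ v → Before? v a b) (λ x → Before? x a b) (list E₁) (list E₂)
      λ _ y∈ → Before-⊕ˡ n₁ (IsPerm⇒≥1 (InPre⇒IsPerm (∈⁻ E₂ y∈))) a≤n₁ b≤n₁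

  #before-⊕ʳ : ∀ {a b} → 1 ≤ a → #before (n₁ + a) (n₁ + b) ≡ size E₁ * C₂.#before a b
  #before-⊕ʳ {a} {b} 1≤a =
    length-filter-cartesianProductWithʳ (n₁ ⊕_) (λ v → Before? v (n₁ + a) (n₁ + b)) (λ y → Before? y a b)
      (list E₁) (list E₂) λ x∈ _ → Before-⊕ʳ n₁ (IsPerm⇒≤ (InPre⇒IsPerm (∈⁻ E₁ x∈))) 1≤a

  Majority-⊕ˡ : ∀ {a b} → a ≤ n₁ → b ≤ n₁ → Majority N i a b ⇔ Majority n₁ i₁ a b
  Majority-⊕ˡ {a} {b} a≤n₁ b≤n₁ = begin
    Majority N i a b                                     ≈⟨ Majority⇔#before a b ⟩
    #before b a < #before a b                            ≡⟨ cong₂ _<_ (#before-⊕ˡ b≤n₁ a≤n₁) (#before-⊕ˡ a≤n₁ b≤n₁) ⟩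
    C₁.#before b a * size E₂ < C₁.#before a b * size E₂  ≈⟨ x*m<y*m⇔x<y C₂.size≥1 ⟩
    C₁.#before b a < C₁.#before a b                      ≈⟨ C₁.Majority⇔#before a b ⟨
    Majority n₁ i₁ a b                                   ∎
    where open ⇔-Reasoning

  Majority-⊕ʳ : ∀ {a b} → 1 ≤ a → 1 ≤ b → Majority N i (n₁ + a) (n₁ + b) ⇔ Majority n₂ i₂ a b
  Majority-⊕ʳ {a} {b} 1≤a 1≤b = begin
    Majority N i (n₁ + a) (n₁ + b)                         ≈⟨ Majority⇔#before (n₁ + a) (n₁ + b) ⟩
    #before (n₁ + b) (n₁ + a) < #before (n₁ + a) (n₁ + b)  ≡⟨ cong₂ _<_ (#before-⊕ʳ 1≤b) (#before-⊕ʳ 1≤a) ⟩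
    size E₁ * C₂.#before b a < size E₁ * C₂.#before a b    ≈⟨ m*x<m*y⇔x<y C₁.size≥1 ⟩
    C₂.#before b a < C₂.#before a b                        ≈⟨ C₂.Majority⇔#before a b ⟨
    Majority n₂ i₂ a b                                     ∎
    where open ⇔-Reasoning

  Majority-⊕-across : ∀ {a b} → 1 ≤ a → a ≤ n₁ → 1 ≤ b → b ≤ n₂ → Majority N i a (n₁ + b)
  Majority-⊕-across {a} {b} 1≤a a≤n₁ 1≤b b≤n₂ =
    Majority-unanimous (<⇒≢ (≤-<-trans a≤n₁ (m<m+n n₁ 1≤b))) 1≤a (≤-trans a≤n₁ (m≤m+n n₁ n₂))
      (≤-trans 1≤b (m≤n+m b n₁)) (+-monoʳ-≤ n₁ b≤n₂) never
    where
    never : ∀ {v} → InPre N i v → ¬ Before v (n₁ + b) a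
    never v∈ with x , y , x∈ , y∈ , refl ← InPre-⊕⁻ v∈ =
      ¬Before-⊕-down n₁ (IsPerm⇒≤ (InPre⇒IsPerm x∈)) (IsPerm⇒≥1 (InPre⇒IsPerm y∈)) (m<m+n n₁ 1≤b) a≤n₁

data Block (n₁ n₂ : ℕ) : ℕ → Set where
  low  : ∀ {a} → 1 ≤ a → a ≤ n₁ → Block n₁ n₂ a
  high : ∀ {a} → 1 ≤ a → a ≤ n₂ → Block n₁ n₂ (n₁ + a)

block : ∀ n₁ n₂ {a} → 1 ≤ a → a ≤ n₁ + n₂ → Block n₁ n₂ a
block n₁ n₂ {a} 1≤a a≤N with a ≤? n₁
... | yes a≤n₁ = low 1≤a a≤n₁
... | no a≰n₁ with a′ , refl ← m≤n⇒∃[o]m+o≡n (<⇒≤ (≰⇒> a≰n₁)) =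
  high (m<m+n⇒0<n n₁ (≰⇒> a≰n₁)) (+-cancelˡ-≤ n₁ a′ n₂ a≤N)

proposition5p5 : (n₁ n₂ : ℕ) (w₁ w₂ : List ℕ) → IsPerm n₁ w₁ → IsPerm n₂ w₂ →
  (i : List ℕ) → IsReducedWord (n₁ + n₂) (_⊕_ n₁ w₁ w₂) i →
  (u₁ v₁ u₂ v₂ : List ℕ) →
  InPre n₁ (lowPart n₁ i) u₁ →
  InPre n₁ (lowPart n₁ i) v₁ →
  InPre n₂ (highPart n₁ i) u₂ →
  InPre n₂ (highPart n₁ i) v₂ →
  (∀ a b → InInv u₁ a b ⇔ (InInv w₁ a b × TallyGt n₁ (lowPart n₁ i) a b)) →
  (∀ a b → InInv v₁ a b ⇔ (InInv w₁ a b × TallyGe n₁ (lowPart n₁ i) a b)) →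
  (∀ a b → InInv u₂ a b ⇔ (InInv w₂ a b × TallyGt n₂ (highPart n₁ i) a b)) →
  (∀ a b → InInv v₂ a b ⇔ (InInv w₂ a b × TallyGe n₂ (highPart n₁ i) a b)) →
  ∀ a b → 1 ≤ a → a ≤ n₁ + n₂ → 1 ≤ b → b ≤ n₁ + n₂ →
  Majority (n₁ + n₂) i a b ⇔
    (Before (_⊕_ n₁ u₁ u₂) a b × Before (_⊕_ n₁ v₁ v₂) a b)
proposition5p5 n₁ n₂ w₁ w₂ w₁-perm w₂-perm i i-reduced u₁ v₁ u₂ v₂ u₁∈ v₁∈ u₂∈ v₂∈ u₁-inv v₁-inv u₂-inv v₂-inv
               a b 1≤a a≤N 1≤b b≤N = by-blocks (block n₁ n₂ 1≤a a≤N) (block n₁ n₂ 1≤b b≤N)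
  where
  open DirectSum w₁-perm w₂-perm i-reduced
  open ⇔-Reasoning
  ≥1 : ∀ {n k x} → InPre n k x → All (1 ≤_) x
  ≥1 = IsPerm⇒≥1 ∘ InPre⇒IsPerm
  ≤n : ∀ {n k x} → InPre n k x → All (_≤ n) x
  ≤n = IsPerm⇒≤ ∘ InPre⇒IsPerm
  by-blocks : ∀ {a b} → Block n₁ n₂ a → Block n₁ n₂ b →
              Majority (n₁ + n₂) i a b ⇔ (Before ((n₁ ⊕ u₁) u₂) a b × Before ((n₁ ⊕ v₁) v₂) a b)
  by-blocks {a} {b} (low 1≤a a≤n₁) (low 1≤b b≤n₁) = begin
    Majority (n₁ + n₂) i a b          ≈⟨ Majority-⊕ˡ a≤n₁ b≤n₁ ⟩
    Majority n₁ (lowPart n₁ i) a b    ≈⟨ Majority⇔Before-both Pre₁≤ʷw₁ u₁∈ v₁∈ u₁-inv v₁-inv 1≤a a≤n₁ 1≤b b≤n₁ ⟩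
    (Before u₁ a b × Before v₁ a b)   ≈⟨ Before-⊕ˡ n₁ (≥1 u₂∈) a≤n₁ b≤n₁ ×-⇔ Before-⊕ˡ n₁ (≥1 v₂∈) a≤n₁ b≤n₁ ⟨
    (Before ((n₁ ⊕ u₁) u₂) a b × Before ((n₁ ⊕ v₁) v₂) a b) ∎
  by-blocks (high {a} 1≤a a≤n₂) (high {b} 1≤b b≤n₂) = begin
    Majority (n₁ + n₂) i (n₁ + a) (n₁ + b)  ≈⟨ Majority-⊕ʳ 1≤a 1≤b ⟩
    Majority n₂ (highPart n₁ i) a b         ≈⟨ Majority⇔Before-both Pre₂≤ʷw₂ u₂∈ v₂∈ u₂-inv v₂-inv 1≤a a≤n₂ 1≤b b≤n₂ ⟩
    (Before u₂ a b × Before v₂ a b)         ≈⟨ Before-⊕ʳ n₁ (≤n u₁∈) 1≤a ×-⇔ Before-⊕ʳ n₁ (≤n v₁∈) 1≤a ⟨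
    (Before ((n₁ ⊕ u₁) u₂) (n₁ + a) (n₁ + b) × Before ((n₁ ⊕ v₁) v₂) (n₁ + a) (n₁ + b)) ∎
  by-blocks (low 1≤a a≤n₁) (high 1≤b b≤n₂) = mk⇔
    (λ _ → Before-⊕-Pre-across u₁∈ u₂∈ 1≤a a≤n₁ 1≤b b≤n₂ , Before-⊕-Pre-across v₁∈ v₂∈ 1≤a a≤n₁ 1≤b b≤n₂)
    (λ _ → Majority-⊕-across 1≤a a≤n₁ 1≤b b≤n₂)
  by-blocks (high 1≤a a≤n₂) (low 1≤b b≤n₁) = mk⇔
    (λ ab → ⊥-elim (Majority-asym ab (Majority-⊕-across 1≤b b≤n₁ 1≤a a≤n₂)))
    (λ (ab , _) → ⊥-elim (¬Before-⊕-down n₁ (≤n u₁∈) (≥1 u₂∈) (m<m+n n₁ 1≤a) b≤n₁ ab))
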